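{- Let $r\geq 0$ and $s>0$ be integers, let $n=p^m$ be a prime power ($p$ prime, $m\geq 1$), and let $\chi_1,\ldots,\chi_s$ be Dirichlet characters modulo $n$ with conductors $p^{t_1},\ldots,p^{t_s}$ ($0\le t_i\le m$). Let $u=\max\{t_1,\ldots,t_s\}$ and \[ S=\sum_{\substack{a_1,\ldots,a_s\in\mathbb{Z}_n^\ast\\ b_1,\ldots,b_r\in\mathbb{Z}_n}}\gcd(a_1-1,\ldots,a_s-1,b_1,\ldots,b_r,n)\,\chi_1(a_1)\cdots\chi_s(a_s). \] Then $S=\varphi(p^m)\,\sigma_{s+r-1}(p^{m-u})$ if $u>0$, and $S=\varphi(p^m)\left(\varphi(p^m)^{s-1}p^{mr}+\sigma_{s+r-1}(p^m)-p^{m(s+r-1)}\right)$ if $u=0$.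
   Context: $\mathbb{Z}_n=\mathbb{Z}/n\mathbb{Z}$ and $\mathbb{Z}_n^\ast$ is its group of units; gcds are computed with integer representatives. $\varphi$ is Euler's totient function and $\sigma_k(N)=\sum_{e\mid N}e^k$. -}

module Defs where

open import Level using (Level; _⊔_)
open import Data.Nat as ℕ using (ℕ; zero; suc; _∸_; _^_; _≤_; ∣_-_∣)
open import Data.Nat.ListAction using () renaming (sum to sumℕ)
open import Data.Nat.GCD using (gcd)
open import Data.Nat.Divisibility using (_∣_; _∣?_)
open import Data.Fin using (Fin)
open import Data.Vec as Vec using (Vec; []; _∷_; lookup)
open import Data.List as List using (List; []; _∷_; map; foldr; upTo; allFin; _++_)
open import Data.Product using (_×_)
open import Data.Sum using (_⊎_)
open import Relation.Nullary using (¬_; Dec; yes; no)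
open import Relation.Unary using (Pred; Decidable)
open import Relation.Binary.PropositionalEquality using (_≡_)
open import Algebra.Bundles using (CommutativeRing)

range1 : ℕ → List ℕ
range1 N = map suc (upTo N)

count : {A : Set} {P : Pred A Level.zero} → Decidable P → List A → ℕ
count P? [] = 0
count P? (x ∷ xs) with P? x
... | yes _ = suc (count P? xs)
... | no  _ = count P? xs

φ : ℕ → ℕ
φ N = count (λ a → gcd a N ℕ.≟ 1) (range1 N)

σ : ℕ → ℕ → ℕ
σ k N = sumℕ (map (_^ k) (List.filter (_∣? N) (range1 N)))

_≡_[mod_] : ℕ → ℕ → ℕ → Set
a ≡ b [mod d ] = d ∣ ∣ a - b ∣

gcdList : List ℕ → ℕ → ℕ
gcdList xs n = foldr gcd n xs

maxFin : (s : ℕ) → (Fin s → ℕ) → ℕ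
maxFin s t = foldr ℕ._⊔_ 0 (map t (allFin s))

module _ {c ℓ : Level} (R : CommutativeRing c ℓ) where
  open CommutativeRing R

  ι : ℕ → Carrier
  ι zero    = 0#
  ι (suc k) = 1# + ι k

  -- integral domain of characteristic zero (abstract stand-in for ℂ)
  record IsIntegralDomainChar0 : Set (c ⊔ ℓ) where
    field
      nontrivial    : ¬ (1# ≈ 0#)
      noZeroDivisor : ∀ x y → x * y ≈ 0# → (x ≈ 0#) ⊎ (y ≈ 0#)
      char0         : ∀ k → ¬ (ι (suc k) ≈ 0#)

  -- Dirichlet character modulo n with values in R
  -- (χ : ℤ → R on natural representatives: periodic, completely
  --  multiplicative, χ(1) = 1, and χ(a) = 0 iff gcd(a,n) ≠ 1;
  --  χ(a) is automatically a unit for gcd(a,n) = 1)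
  record DirichletCharacter (n : ℕ) : Set (c ⊔ ℓ) where
    field
      χ        : ℕ → Carrier
      periodic : ∀ a → χ (a ℕ.+ n) ≈ χ a
      mult     : ∀ a b → χ (a ℕ.* b) ≈ χ a * χ b
      χ1       : χ 1 ≈ 1#
      vanish   : ∀ a → ¬ (gcd a n ≡ 1) → χ a ≈ 0#

  open DirichletCharacter public

  InducedModulus : {n : ℕ} → DirichletCharacter n → ℕ → Set ℓ
  InducedModulus {n} ch d = ∀ a → gcd a n ≡ 1 → a ≡ 1 [mod d ] → χ ch a ≈ 1#

  HasConductor : {n : ℕ} → DirichletCharacter n → ℕ → Set ℓ
  HasConductor {n} ch f =
    f ∣ n × InducedModulus ch f × (∀ d → d ∣ n → InducedModulus ch d → f ≤ d)

  sumL : List ℕ → (ℕ → Carrier) → Carrier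
  sumL xs f = foldr (λ x acc → f x + acc) 0# xs

  prodFin : (s : ℕ) → (Fin s → Carrier) → Carrier
  prodFin s f = foldr (λ i acc → f i * acc) 1# (allFin s)

  sumTuples : List ℕ → (k : ℕ) → (Vec ℕ k → Carrier) → Carrier
  sumTuples xs zero    f = f []
  sumTuples xs (suc k) f = sumL xs (λ x → sumTuples xs k (λ v → f (x ∷ v)))

  residues : ℕ → List ℕ
  residues n = upTo n

  units : ℕ → List ℕ
  units n = List.filter (λ a → gcd a n ℕ.≟ 1) (upTo n)

  -- S = Σ_{a ∈ (ℤ_n^*)^s, b ∈ ℤ_n^r} gcd(a₁-1,…,a_s-1,b₁,…,b_r,n) χ₁(a₁)⋯χ_s(a_s)
  -- (aᵢ ≥ 1 for units when n ≥ 2, so aᵢ ∸ 1 = aᵢ - 1)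
  Ssum : (n r s : ℕ) → (Fin s → DirichletCharacter n) → Carrier
  Ssum n r s chs =
    sumTuples (units n) s λ a →
    sumTuples (residues n) r λ b →
      ι (gcdList (Vec.toList (Vec.map (_∸ 1) a) ++ Vec.toList b) n)
        * prodFin s (λ i → χ (chs i) (lookup a i))

module Submission where

-- Write N = p^m.  Every divisor of N is p^k with k ≤ m, and
-- p^k = Σ_{j ≤ k} w_j with w_0 = 1, w_j = p^{j-1}(p-1).  Hence for any
-- finite family z of naturals,  gcd(z, N) = Σ_{j ≤ m} w_j ∏_z [p^j ∣ z].
-- Substituting this into S and exchanging sums and products (the tuple
-- sum of a product of one-variable functions is the product of the
-- one-variable sums) gives
--      S = Σ_{j ≤ m} w_j · ∏_i A_i(j) · B(j)^r,
-- where A_i(j) = Σ_{a ∈ ℤ_N^*, a ≡ 1 (p^j)} χ_i(a) and B(j) = #{b ∈ ℤ_N : p^j ∣ b}.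
-- Now B(j) = p^{m-j}.  If j < t_i, then p^j is not an induced modulus of χ_i,
-- and the substitution x ↦ a x (for a unit a ≡ 1 mod p^j) shows
-- A_i(j) = χ_i(a) A_i(j) for every such a; in an integral domain this forces
-- A_i(j) = 0.  If j ≥ t_i, then χ_i ≡ 1 on the summation range and A_i(j) is
-- the number c_j of units ≡ 1 (mod p^j): c_0 = φ(p^m), c_j = p^{m-j}.
-- So only the terms j ≥ u survive, and evaluating that sum in ℕ with
-- σ_K(p^e) = Σ_{i ≤ e} p^{iK} gives the two closed forms.

open import Level using (Level)
open import Data.Nat using (ℕ; NonZero; _≤_; _<_; _^_)
open import Data.Fin using (Fin)
open import Data.Nat.Primality using (Prime)
open import Algebra.Bundles using (CommutativeRing)
open import Defs using (IsIntegralDomainChar0; DirichletCharacter; HasConductor)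

module Indicator where

  open import Data.Nat using (ℕ; _*_)
  open import Relation.Binary.PropositionalEquality using (_≡_; refl; sym)
  open import Relation.Nullary using (¬_; Dec; yes; no)
  open import Data.Empty using (⊥-elim)

  𝟙 : {P : Set} → Dec P → ℕ
  𝟙 (yes _) = 1
  𝟙 (no _)  = 0

  𝟙-yes : {P : Set} (d : Dec P) → P → 𝟙 d ≡ 1
  𝟙-yes (yes _) _ = refl
  𝟙-yes (no ¬p) p = ⊥-elim (¬p p)

  𝟙-no : {P : Set} (d : Dec P) → ¬ P → 𝟙 d ≡ 0
  𝟙-no (yes p) ¬p = ⊥-elim (¬p p)
  𝟙-no (no _)  _  = refl

  𝟙-cong : {P Q : Set} (d : Dec P) (e : Dec Q) → (P → Q) → (Q → P) → 𝟙 d ≡ 𝟙 e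
  𝟙-cong (yes p) (yes q) f g = refl
  𝟙-cong (yes p) (no ¬q) f g = ⊥-elim (¬q (f p))
  𝟙-cong (no ¬p) (yes q) f g = ⊥-elim (¬p (g q))
  𝟙-cong (no _)  (no _)  f g = refl

  𝟙-∧ : {P Q S : Set} (a : Dec P) (b : Dec Q) (c : Dec S) →
    (P → Q → S) → (S → P) → (S → Q) → 𝟙 a * 𝟙 b ≡ 𝟙 c
  𝟙-∧ (yes a) (yes b) c f g h = sym (𝟙-yes c (f a b))
  𝟙-∧ (yes a) (no ¬b) c f g h = sym (𝟙-no c (λ s → ¬b (h s)))
  𝟙-∧ (no ¬a) b       c f g h = sym (𝟙-no c (λ s → ¬a (g s)))

module NatSum where

  open import Data.Nat
  open import Data.Nat.Properties
  open import Data.List using (List; []; _∷_; map; upTo; _++_; [_]; filter)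
  open import Data.List.Properties using (upTo-∷ʳ)
  open import Data.Nat.ListAction using () renaming (sum to sumℕ)
  open import Algebra.Properties.CommutativeSemigroup +-commutativeSemigroup using (interchange)
  open import Relation.Binary.PropositionalEquality hiding ([_])
  open import Relation.Nullary using (yes; no)
  open import Relation.Unary using (Pred; Decidable)
  open import Level using (0ℓ)
  open import Defs using (count)
  open Indicator
  open ≡-Reasoning

  Σℕ : ℕ → (ℕ → ℕ) → ℕ
  Σℕ zero    f = 0
  Σℕ (suc n) f = Σℕ n f + f n

  Σℕ-cong : ∀ n {f g : ℕ → ℕ} → (∀ x → x < n → f x ≡ g x) → Σℕ n f ≡ Σℕ n g
  Σℕ-cong zero    h = refl
  Σℕ-cong (suc n) h = cong₂ _+_ (Σℕ-cong n (λ x x<n → h x (m<n⇒m<1+n x<n))) (h n (n<1+n n))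

  Σℕ-zero : ∀ n (f : ℕ → ℕ) → (∀ x → x < n → f x ≡ 0) → Σℕ n f ≡ 0
  Σℕ-zero zero    f h = refl
  Σℕ-zero (suc n) f h =
    cong₂ _+_ (Σℕ-zero n f (λ x x<n → h x (m<n⇒m<1+n x<n))) (h n (n<1+n n))

  Σℕ-split : ∀ a b f → Σℕ (a + b) f ≡ Σℕ a f + Σℕ b (λ y → f (a + y))
  Σℕ-split a zero    f rewrite +-identityʳ a = sym (+-identityʳ _)
  Σℕ-split a (suc b) f rewrite +-suc a b | Σℕ-split a b f = +-assoc (Σℕ a f) _ _

  Σℕ-cons : ∀ n f → Σℕ (suc n) f ≡ f 0 + Σℕ n (λ i → f (suc i))
  Σℕ-cons n f = Σℕ-split 1 n f

  Σℕ-+ : ∀ n f g → Σℕ n (λ x → f x + g x) ≡ Σℕ n f + Σℕ n g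
  Σℕ-+ zero    f g = refl
  Σℕ-+ (suc n) f g rewrite Σℕ-+ n f g = interchange (Σℕ n f) (Σℕ n g) (f n) (g n)

  Σℕ-*ˡ : ∀ n c f → Σℕ n (λ x → c * f x) ≡ c * Σℕ n f
  Σℕ-*ˡ zero    c f = sym (*-zeroʳ c)
  Σℕ-*ˡ (suc n) c f rewrite Σℕ-*ˡ n c f = sym (*-distribˡ-+ c (Σℕ n f) (f n))

  Σℕ-*ʳ : ∀ n c f → Σℕ n (λ x → f x * c) ≡ Σℕ n f * c
  Σℕ-*ʳ zero    c f = refl
  Σℕ-*ʳ (suc n) c f rewrite Σℕ-*ʳ n c f = sym (*-distribʳ-+ c (Σℕ n f) (f n))

  Σℕ-const : ∀ n c → Σℕ n (λ _ → c) ≡ n * c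
  Σℕ-const zero    c = refl
  Σℕ-const (suc n) c rewrite Σℕ-const n c = +-comm (n * c) c

  Σℕ-swap : ∀ n k (f : ℕ → ℕ → ℕ) →
    Σℕ n (λ x → Σℕ k (λ i → f x i)) ≡ Σℕ k (λ i → Σℕ n (λ x → f x i))
  Σℕ-swap zero    k f = sym (Σℕ-zero k _ (λ _ _ → refl))
  Σℕ-swap (suc n) k f rewrite Σℕ-swap n k f = sym (Σℕ-+ k (λ i → Σℕ n (λ x → f x i)) (f n))

  Σℕ-periodic : ∀ d q f → (∀ x → f (x + d) ≡ f x) → Σℕ (q * d) f ≡ q * Σℕ d f
  Σℕ-periodic d zero    f h = refl
  Σℕ-periodic d (suc q) f h = begin
    Σℕ (d + q * d) f                       ≡⟨ Σℕ-split d (q * d) f ⟩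
    Σℕ d f + Σℕ (q * d) (λ y → f (d + y))  ≡⟨ cong (Σℕ d f +_) shifted ⟩
    Σℕ d f + q * Σℕ d f                    ∎
    where
    shifted : Σℕ (q * d) (λ y → f (d + y)) ≡ q * Σℕ d f
    shifted = trans (Σℕ-cong (q * d) (λ y _ → trans (cong f (+-comm d y)) (h y)))
                    (Σℕ-periodic d q f h)

  Σℕ-point : ∀ n c → c < n → Σℕ n (λ x → 𝟙 (x ≟ c)) ≡ 1
  Σℕ-point (suc n) c c<sn with n ≟ c
  ... | yes refl = cong (_+ 1) (Σℕ-zero n _ (λ x x<n → 𝟙-no (x ≟ n) (<⇒≢ x<n)))
  ... | no n≢c   = trans (+-identityʳ _) (Σℕ-point n c (≤∧≢⇒< (≤-pred c<sn) (λ e → n≢c (sym e))))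

  Σℕ-shift : ∀ n f → Σℕ n (λ x → f (suc x)) + f 0 ≡ Σℕ n f + f n
  Σℕ-shift n f = begin
    Σℕ n (λ x → f (suc x)) + f 0 ≡⟨ +-comm _ (f 0) ⟩
    f 0 + Σℕ n (λ x → f (suc x)) ≡⟨ sym (Σℕ-cons n f) ⟩
    Σℕ n f + f n                 ∎

  Σℕ-rev : ∀ n f → Σℕ n f ≡ Σℕ n (λ i → f (n ∸ suc i))
  Σℕ-rev zero    f = refl
  Σℕ-rev (suc n) f = begin
    Σℕ n f + f n                          ≡⟨ cong (_+ f n) (Σℕ-rev n f) ⟩
    Σℕ n (λ i → f (n ∸ suc i)) + f n      ≡⟨ +-comm _ (f n) ⟩
    f n + Σℕ n (λ i → f (n ∸ suc i))      ≡⟨ sym (Σℕ-cons n (λ i → f (n ∸ i))) ⟩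
    Σℕ (suc n) (λ i → f (n ∸ i))          ∎

  Σℕ-prefix : ∀ k d h → Σℕ (k + d) (λ i → 𝟙 (i <? k) * h i) ≡ Σℕ k h
  Σℕ-prefix k d h = begin
    Σℕ (k + d) F                      ≡⟨ Σℕ-split k d F ⟩
    Σℕ k F + Σℕ d (λ y → F (k + y))   ≡⟨ cong₂ _+_ inside outside ⟩
    Σℕ k h + 0                        ≡⟨ +-identityʳ _ ⟩
    Σℕ k h                            ∎
    where
    F = λ i → 𝟙 (i <? k) * h i
    inside : Σℕ k F ≡ Σℕ k h
    inside = Σℕ-cong k (λ i i<k → trans (cong (_* h i) (𝟙-yes (i <? k) i<k)) (*-identityˡ (h i)))
    outside : Σℕ d (λ y → F (k + y)) ≡ 0
    outside = Σℕ-zero d _ (λ y _ → cong (_* h (k + y)) (𝟙-no (k + y <? k) (λ lt → <⇒≱ lt (m≤m+n k y))))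

  sumList : List ℕ → (ℕ → ℕ) → ℕ
  sumList []       f = 0
  sumList (x ∷ xs) f = f x + sumList xs f

  sumList-++ : ∀ xs ys f → sumList (xs ++ ys) f ≡ sumList xs f + sumList ys f
  sumList-++ []       ys f = refl
  sumList-++ (x ∷ xs) ys f rewrite sumList-++ xs ys f = sym (+-assoc (f x) _ _)

  sumList-upTo : ∀ n f → sumList (upTo n) f ≡ Σℕ n f
  sumList-upTo zero    f = refl
  sumList-upTo (suc n) f = begin
    sumList (upTo (suc n)) f         ≡⟨ cong (λ l → sumList l f) (sym (upTo-∷ʳ n)) ⟩
    sumList (upTo n ++ [ n ]) f      ≡⟨ sumList-++ (upTo n) [ n ] f ⟩
    sumList (upTo n) f + (f n + 0)   ≡⟨ cong₂ _+_ (sumList-upTo n f) (+-identityʳ (f n)) ⟩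
    Σℕ n f + f n                     ∎

  sumList-map : ∀ xs g f → sumList (map g xs) f ≡ sumList xs (λ x → f (g x))
  sumList-map []       g f = refl
  sumList-map (x ∷ xs) g f = cong (f (g x) +_) (sumList-map xs g f)

  count-sumList : {P : Pred ℕ 0ℓ} (P? : Decidable P) → ∀ xs →
    count P? xs ≡ sumList xs (λ x → 𝟙 (P? x))
  count-sumList P? []       = refl
  count-sumList P? (x ∷ xs) with P? x
  ... | yes _ = cong suc (count-sumList P? xs)
  ... | no _  = count-sumList P? xs

  sumℕ-filter : {P : Pred ℕ 0ℓ} (P? : Decidable P) → ∀ xs g →
    sumℕ (map g (filter P? xs)) ≡ sumList xs (λ x → 𝟙 (P? x) * g x)
  sumℕ-filter P? []       g = refl
  sumℕ-filter P? (x ∷ xs) g with P? x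
  ... | yes _ = cong₂ _+_ (sym (+-identityʳ (g x))) (sumℕ-filter P? xs g)
  ... | no _  = sumℕ-filter P? xs g

module PrimePower (p : ℕ) (pr : Prime p) where

  open import Defs using (φ; σ)
  open import Data.Nat
  open import Data.Nat.Properties
  open import Data.Nat.Primality using (prime⇒nonZero; prime⇒nonTrivial; prime⇒irreducible)
  open import Data.Nat.DivMod
  open import Data.Nat.Divisibility
  open import Data.Nat.GCD
  open import Data.Nat.Coprimality using (Coprime; coprime-divisor; coprime⇒gcd≡1)
  open import Data.List using (map; upTo)
  open import Relation.Binary.PropositionalEquality
  open import Relation.Nullary using (¬_; yes; no)
  open import Data.Empty using (⊥-elim)
  open import Data.Sum using (inj₁; inj₂)
  open import Data.Product using (Σ; _×_; _,_)
  open Indicator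
  open NatSum
  open ≡-Reasoning

  instance
    p-nonZero : NonZero p
    p-nonZero = prime⇒nonZero pr

  pow-nonZero : ∀ {k} → NonZero (p ^ k)
  pow-nonZero {k} = m^n≢0 p k

  1<p : 1 < p
  1<p = nonTrivial⇒n>1 p {{prime⇒nonTrivial pr}}

  pow≥1 : ∀ k → 1 ≤ p ^ k
  pow≥1 k = m^n>0 p k

  1<pow : ∀ j → 1 ≤ j → 1 < p ^ j
  1<pow j 1≤j = ^-monoʳ-< p 1<p {0} {j} 1≤j

  pow-split : ∀ m j → j ≤ m → p ^ m ≡ p ^ (m ∸ j) * p ^ j
  pow-split m j j≤m = trans (cong (p ^_) (sym (m∸n+n≡m j≤m))) (^-distribˡ-+-* p (m ∸ j) j)

  pow∣pow : ∀ {j k} → j ≤ k → p ^ j ∣ p ^ k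
  pow∣pow {j} {k} j≤k = divides (p ^ (k ∸ j)) (pow-split k j j≤k)

  pow∣pow⁻¹ : ∀ {j k} → p ^ j ∣ p ^ k → j ≤ k
  pow∣pow⁻¹ {j} {k} h with j ≤? k
  ... | yes j≤k = j≤k
  ... | no j≰k  = ⊥-elim (<⇒≱ (^-monoʳ-< p 1<p {k} {j} (≰⇒> j≰k)) (∣⇒≤ {{pow-nonZero {k}}} h))

  pow-injective : ∀ {i j} → p ^ i ≡ p ^ j → i ≡ j
  pow-injective {i} {j} e =
    ≤-antisym (pow∣pow⁻¹ {i} {j} (∣-reflexive e)) (pow∣pow⁻¹ {j} {i} (∣-reflexive (sym e)))

  p∣pow : ∀ m → 1 ≤ m → p ∣ p ^ m
  p∣pow (suc m) _ = m∣m*n (p ^ m)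

  divisor-of-pow : ∀ e {d} → d ∣ p ^ e → Σ ℕ (λ i → i ≤ e × d ≡ p ^ i)
  divisor-of-pow zero    d∣1 = 0 , z≤n , ∣1⇒≡1 d∣1
  divisor-of-pow (suc e) {d} d∣ with p ∣? d
  ... | yes (divides q refl) with divisor-of-pow e {q} (*-cancelʳ-∣ {q} {p ^ e} p (subst (q * p ∣_) (*-comm p (p ^ e)) d∣))
  ...   | i , i≤e , q≡ = suc i , s≤s i≤e , trans (cong (_* p) q≡) (*-comm (p ^ i) p)
  divisor-of-pow (suc e) {d} d∣ | no ¬p∣d with divisor-of-pow e (coprime-divisor d-coprime-p d∣)
    where
    d-coprime-p : Coprime d p
    d-coprime-p (c∣d , c∣p) with prime⇒irreducible pr c∣p
    ... | inj₁ c≡1 = c≡1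
    ... | inj₂ refl = ⊥-elim (¬p∣d c∣d)
  ...   | i , i≤e , eq = i , m≤n⇒m≤1+n i≤e , eq

  unit⇒¬p∣ : ∀ {x m} → 1 ≤ m → gcd x (p ^ m) ≡ 1 → ¬ p ∣ x
  unit⇒¬p∣ {x} {m} 1≤m g≡1 p∣x =
    <⇒≢ 1<p (sym (∣1⇒≡1 (subst (p ∣_) g≡1 (gcd-greatest p∣x (p∣pow m 1≤m)))))

  ¬p∣⇒unit : ∀ {x m} → ¬ p ∣ x → gcd x (p ^ m) ≡ 1
  ¬p∣⇒unit {x} {m} ¬p∣x = coprime⇒gcd≡1 x-coprime
    where
    x-coprime : Coprime x (p ^ m)
    x-coprime {c} (c∣x , c∣pm) with divisor-of-pow m c∣pm
    ... | zero  , _ , c≡1  = c≡1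
    ... | suc i , _ , refl = ⊥-elim (¬p∣x (∣-trans (p∣pow (suc i) (s≤s z≤n)) c∣x))

  0-nonunit : ∀ m → 1 ≤ m → ¬ (gcd 0 (p ^ m) ≡ 1)
  0-nonunit m 1≤m h = unit⇒¬p∣ {0} {m} 1≤m h (divides 0 refl)

  -- the weights: w 0 = 1 and w (j+1) = φ(p^(j+1)) = p^j (p - 1)
  w : ℕ → ℕ
  w zero    = 1
  w (suc j) = p ^ j * (p ∸ 1)

  Σw≡pow : ∀ k → Σℕ (suc k) w ≡ p ^ k
  Σw≡pow zero    = refl
  Σw≡pow (suc k) rewrite Σw≡pow k = begin
    p ^ k + p ^ k * (p ∸ 1)      ≡⟨ cong (_+ p ^ k * (p ∸ 1)) (sym (*-identityʳ (p ^ k))) ⟩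
    p ^ k * 1 + p ^ k * (p ∸ 1)  ≡⟨ sym (*-distribˡ-+ (p ^ k) 1 (p ∸ 1)) ⟩
    p ^ k * (1 + (p ∸ 1))        ≡⟨ cong (p ^ k *_) (m+[n∸m]≡n (<⇒≤ 1<p)) ⟩
    p ^ k * p                    ≡⟨ *-comm (p ^ k) p ⟩
    p * p ^ k                    ∎

  divisor-expansion : ∀ m g → g ∣ p ^ m → g ≡ Σℕ (suc m) (λ j → w j * 𝟙 (p ^ j ∣? g))
  divisor-expansion m g g∣ with divisor-of-pow m g∣
  ... | k , k≤m , refl = sym (begin
    Σℕ (suc m) F                                  ≡⟨ cong (λ n → Σℕ (suc n) F) (sym (m+[n∸m]≡n k≤m)) ⟩
    Σℕ (suc k + (m ∸ k)) F                        ≡⟨ Σℕ-split (suc k) (m ∸ k) F ⟩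
    Σℕ (suc k) F + Σℕ (m ∸ k) (λ y → F (suc k + y)) ≡⟨ cong₂ _+_ low high ⟩
    Σℕ (suc k) w + 0                              ≡⟨ +-identityʳ _ ⟩
    Σℕ (suc k) w                                  ≡⟨ Σw≡pow k ⟩
    p ^ k                                         ∎)
    where
    F = λ j → w j * 𝟙 (p ^ j ∣? p ^ k)
    low : Σℕ (suc k) F ≡ Σℕ (suc k) w
    low = Σℕ-cong (suc k) (λ j j<sk →
      trans (cong (w j *_) (𝟙-yes (p ^ j ∣? p ^ k) (pow∣pow (≤-pred j<sk)))) (*-identityʳ (w j)))
    high : Σℕ (m ∸ k) (λ y → F (suc k + y)) ≡ 0
    high = Σℕ-zero (m ∸ k) _ (λ y _ →
      trans (cong (w (suc k + y) *_) (𝟙-no (p ^ (suc k + y) ∣? p ^ k)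
              (λ h → <⇒≱ (s≤s (m≤m+n k y)) (pow∣pow⁻¹ {suc k + y} {k} h))))
            (*-zeroʳ (w (suc k + y))))

  count-multiples : ∀ m j → j ≤ m → Σℕ (p ^ m) (λ x → 𝟙 (p ^ j ∣? x)) ≡ p ^ (m ∸ j)
  count-multiples m j j≤m = begin
    Σℕ (p ^ m) F                   ≡⟨ cong (λ n → Σℕ n F) (pow-split m j j≤m) ⟩
    Σℕ (p ^ (m ∸ j) * d) F         ≡⟨ Σℕ-periodic d (p ^ (m ∸ j)) F multiple-periodic ⟩
    p ^ (m ∸ j) * Σℕ d F           ≡⟨ cong (p ^ (m ∸ j) *_) onePeriod ⟩
    p ^ (m ∸ j) * 1                ≡⟨ *-identityʳ _ ⟩
    p ^ (m ∸ j)                    ∎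
    where
    d = p ^ j
    F = λ x → 𝟙 (d ∣? x)
    multiple-periodic : ∀ x → F (x + d) ≡ F x
    multiple-periodic x = 𝟙-cong (d ∣? x + d) (d ∣? x)
      (λ h → ∣m+n∣m⇒∣n (subst (d ∣_) (+-comm x d) h) (∣-refl {d}))
      (λ h → ∣m∣n⇒∣m+n h (∣-refl {d}))
    below-d : ∀ {x} → x < d → d ∣ x → x ≡ 0
    below-d {zero}  _   _ = refl
    below-d {suc x} x<d h = ⊥-elim (<⇒≱ x<d (∣⇒≤ h))
    onePeriod : Σℕ d F ≡ 1
    onePeriod = trans (Σℕ-cong d (λ x x<d → 𝟙-cong (d ∣? x) (x ≟ 0) (below-d x<d) (λ { refl → divides 0 refl })))
                      (Σℕ-point d 0 (pow≥1 j))

  count-units≡1 : ∀ m j → 1 ≤ j → j ≤ m →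
    Σℕ (p ^ m) (λ x → 𝟙 (gcd x (p ^ m) ≟ 1) * 𝟙 (p ^ j ∣? x ∸ 1)) ≡ p ^ (m ∸ j)
  count-units≡1 m j 1≤j j≤m = begin
    Σℕ (p ^ m) G                   ≡⟨ Σℕ-cong (p ^ m) (λ x _ → 𝟙-∧ (gcd x (p ^ m) ≟ 1) (d ∣? x ∸ 1) (x % d ≟ 1)
                                                                  (residue-one x) (unit x) (congruent x)) ⟩
    Σℕ (p ^ m) F                   ≡⟨ cong (λ n → Σℕ n F) (pow-split m j j≤m) ⟩
    Σℕ (p ^ (m ∸ j) * d) F         ≡⟨ Σℕ-periodic d (p ^ (m ∸ j)) F (λ x → cong (λ z → 𝟙 (z ≟ 1)) ([m+n]%n≡m%n x d)) ⟩
    p ^ (m ∸ j) * Σℕ d F           ≡⟨ cong (p ^ (m ∸ j) *_) onePeriod ⟩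
    p ^ (m ∸ j) * 1                ≡⟨ *-identityʳ _ ⟩
    p ^ (m ∸ j)                    ∎
    where
    d = p ^ j
    instance
      d-nonZero : NonZero d
      d-nonZero = pow-nonZero {j}
    F = λ x → 𝟙 (x % d ≟ 1)
    G = λ x → 𝟙 (gcd x (p ^ m) ≟ 1) * 𝟙 (d ∣? x ∸ 1)
    onePeriod : Σℕ d F ≡ 1
    onePeriod = trans (Σℕ-cong d (λ x x<d → cong (λ z → 𝟙 (z ≟ 1)) (m<n⇒m%n≡m x<d)))
                      (Σℕ-point d 1 (1<pow j 1≤j))
    -- x % d = 1 is the same as being a unit with d ∣ x - 1, since p ∣ d
    division : ∀ x → x % d ≡ 1 → x ≡ 1 + x / d * d
    division x e = trans (m≡m%n+[m/n]*n x d) (cong (_+ (x / d) * d) e)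
    residue-one : ∀ x → gcd x (p ^ m) ≡ 1 → d ∣ x ∸ 1 → x % d ≡ 1
    residue-one zero    g _                = ⊥-elim (0-nonunit m (≤-trans 1≤j j≤m) g)
    residue-one (suc x) g (divides q refl) = trans ([m+kn]%n≡m%n 1 q d) (m<n⇒m%n≡m (1<pow j 1≤j))
    congruent : ∀ x → x % d ≡ 1 → d ∣ x ∸ 1
    congruent x e = divides (x / d) (cong (_∸ 1) (division x e))
    unit : ∀ x → x % d ≡ 1 → gcd x (p ^ m) ≡ 1
    unit x e = ¬p∣⇒unit {x} {m} λ p∣x → <⇒≢ 1<p (sym (∣1⇒≡1 (∣m+n∣m⇒∣n
      (subst (p ∣_) (trans (division x e) (+-comm 1 (x / d * d))) p∣x)
      (∣n⇒∣m*n (x / d) (subst (_∣ d) (*-identityʳ p) (pow∣pow {1} {j} 1≤j))))))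

  count-units : ∀ m → 1 ≤ m → Σℕ (p ^ m) (λ x → 𝟙 (gcd x (p ^ m) ≟ 1)) ≡ φ (p ^ m)
  count-units m 1≤m = sym (begin
    φ N                                     ≡⟨ count-sumList (λ a → gcd a N ≟ 1) (map suc (upTo N)) ⟩
    sumList (map suc (upTo N)) f            ≡⟨ sumList-map (upTo N) suc f ⟩
    sumList (upTo N) (λ x → f (suc x))      ≡⟨ sumList-upTo N _ ⟩
    Σℕ N (λ x → f (suc x))                  ≡⟨ sym (+-identityʳ _) ⟩
    Σℕ N (λ x → f (suc x)) + 0              ≡⟨ cong (Σℕ N (λ x → f (suc x)) +_) (sym (𝟙-no (gcd 0 N ≟ 1) (0-nonunit m 1≤m))) ⟩
    Σℕ N (λ x → f (suc x)) + f 0            ≡⟨ Σℕ-shift N f ⟩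
    Σℕ N f + f N                            ≡⟨ cong (Σℕ N f +_) (𝟙-no (gcd N N ≟ 1) N-nonunit) ⟩
    Σℕ N f + 0                              ≡⟨ +-identityʳ _ ⟩
    Σℕ N f                                  ∎)
    where
    N = p ^ m
    f = λ x → 𝟙 (gcd x N ≟ 1)
    N-nonunit : ¬ (gcd N N ≡ 1)
    N-nonunit h = unit⇒¬p∣ {N} {m} 1≤m h (p∣pow m 1≤m)

  -- φ(p^(m+1)) = p^m (p - 1): units and multiples of p partition ℤ_{p^(m+1)}
  φ-pow : ∀ m → φ (p ^ suc m) ≡ p ^ m * (p ∸ 1)
  φ-pow m = +-cancelʳ-≡ (p ^ m) _ _ (begin
    φ N + p ^ m                              ≡⟨ cong₂ _+_ (sym (count-units (suc m) (s≤s z≤n))) (sym multiples) ⟩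
    Σℕ N U + Σℕ N D                          ≡⟨ sym (Σℕ-+ N U D) ⟩
    Σℕ N (λ x → U x + D x)                   ≡⟨ Σℕ-cong N (λ x _ → partition x) ⟩
    Σℕ N (λ _ → 1)                           ≡⟨ Σℕ-const N 1 ⟩
    N * 1                                    ≡⟨ *-identityʳ N ⟩
    p * p ^ m                                ≡⟨ *-comm p (p ^ m) ⟩
    p ^ m * p                                ≡⟨ cong (p ^ m *_) (sym (m∸n+n≡m (<⇒≤ 1<p))) ⟩
    p ^ m * ((p ∸ 1) + 1)                    ≡⟨ *-distribˡ-+ (p ^ m) (p ∸ 1) 1 ⟩
    p ^ m * (p ∸ 1) + p ^ m * 1              ≡⟨ cong (p ^ m * (p ∸ 1) +_) (*-identityʳ (p ^ m)) ⟩
    p ^ m * (p ∸ 1) + p ^ m                  ∎)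
    where
    N = p ^ suc m
    U = λ x → 𝟙 (gcd x N ≟ 1)
    D = λ x → 𝟙 (p ∣? x)
    multiples : Σℕ N D ≡ p ^ m
    multiples = trans (Σℕ-cong N (λ x _ → 𝟙-cong (p ∣? x) (p ^ 1 ∣? x)
                         (subst (_∣ x) (sym (*-identityʳ p))) (subst (_∣ x) (*-identityʳ p))))
                      (count-multiples (suc m) 1 (s≤s z≤n))
    partition : ∀ x → U x + D x ≡ 1
    partition x with gcd x N ≟ 1 | p ∣? x
    ... | yes u  | yes d  = ⊥-elim (unit⇒¬p∣ {x} {suc m} (s≤s z≤n) u d)
    ... | yes u  | no _   = refl
    ... | no _   | yes _  = refl
    ... | no nu  | no nd  = ⊥-elim (nu (¬p∣⇒unit {x} {suc m} nd))

  divides-pow-indicator : ∀ e y → 𝟙 (y ∣? p ^ e) ≡ Σℕ (suc e) (λ i → 𝟙 (y ≟ p ^ i))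
  divides-pow-indicator e y with y ∣? p ^ e
  ... | yes h with divisor-of-pow e h
  ...   | i₀ , i₀≤e , refl = sym (trans
            (Σℕ-cong (suc e) (λ i _ → 𝟙-cong (p ^ i₀ ≟ p ^ i) (i ≟ i₀)
               (λ q → sym (pow-injective {i₀} {i} q)) (λ q → cong (p ^_) (sym q))))
            (Σℕ-point (suc e) i₀ (s≤s i₀≤e)))
  divides-pow-indicator e y | no ¬h =
    sym (Σℕ-zero (suc e) _ (λ i i<se → 𝟙-no (y ≟ p ^ i) (λ { refl → ¬h (pow∣pow (≤-pred i<se)) })))

  σ-pow : ∀ k e → σ k (p ^ e) ≡ Σℕ (suc e) (λ i → (p ^ i) ^ k)
  σ-pow k e = begin
    σ k N
      ≡⟨ sumℕ-filter (_∣? N) (map suc (upTo N)) (_^ k) ⟩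
    sumList (map suc (upTo N)) (λ x → 𝟙 (x ∣? N) * x ^ k)
      ≡⟨ trans (sumList-map (upTo N) suc _) (sumList-upTo N _) ⟩
    Σℕ N (λ x → 𝟙 (suc x ∣? N) * suc x ^ k)
      ≡⟨ Σℕ-cong N (λ x _ → trans (cong (_* suc x ^ k) (divides-pow-indicator e (suc x))) (sym (Σℕ-*ʳ (suc e) (suc x ^ k) _))) ⟩
    Σℕ N (λ x → Σℕ (suc e) (λ i → 𝟙 (suc x ≟ p ^ i) * suc x ^ k))
      ≡⟨ Σℕ-cong N (λ x _ → Σℕ-cong (suc e) (λ i _ → shift-index x i)) ⟩
    Σℕ N (λ x → Σℕ (suc e) (λ i → 𝟙 (x ≟ p ^ i ∸ 1) * (p ^ i) ^ k))
      ≡⟨ Σℕ-swap N (suc e) _ ⟩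
    Σℕ (suc e) (λ i → Σℕ N (λ x → 𝟙 (x ≟ p ^ i ∸ 1) * (p ^ i) ^ k))
      ≡⟨ Σℕ-cong (suc e) (λ i i<se → point i (≤-pred i<se)) ⟩
    Σℕ (suc e) (λ i → (p ^ i) ^ k) ∎
    where
    N = p ^ e
    suc-∸1 : ∀ {P} → 1 ≤ P → suc (P ∸ 1) ≡ P
    suc-∸1 {suc _} _ = refl
    -- the divisor p^i sits at position p^i - 1 of the list 1, …, N
    shift-index : ∀ x i → 𝟙 (suc x ≟ p ^ i) * suc x ^ k ≡ 𝟙 (x ≟ p ^ i ∸ 1) * (p ^ i) ^ k
    shift-index x i with suc x ≟ p ^ i
    ... | yes eq = cong₂ _*_ (sym (𝟙-yes (x ≟ p ^ i ∸ 1) (cong (_∸ 1) eq))) (cong (_^ k) eq)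
    ... | no ne    = sym (cong (_* (p ^ i) ^ k) (𝟙-no (x ≟ p ^ i ∸ 1)
                          (λ e → ne (trans (cong suc e) (suc-∸1 (pow≥1 i))))))
    point : ∀ i → i ≤ e → Σℕ N (λ x → 𝟙 (x ≟ p ^ i ∸ 1) * (p ^ i) ^ k) ≡ (p ^ i) ^ k
    point i i≤e = trans (Σℕ-*ʳ N ((p ^ i) ^ k) _)
      (trans (cong (_* (p ^ i) ^ k) (Σℕ-point N (p ^ i ∸ 1)
                (subst (_≤ N) (sym (suc-∸1 (pow≥1 i))) (^-monoʳ-≤ p i≤e))))
             (*-identityˡ _))

module ClosedForm (p : ℕ) (pr : Prime p) where

  open import Defs using (φ; σ)
  open import Data.Nat
  open import Data.Nat.Properties
  open import Data.Nat.Solver using (module +-*-Solver)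
  open import Relation.Binary.PropositionalEquality
  open Indicator
  open NatSum
  open PrimePower p pr
  open ≡-Reasoning

  -- congruentUnits m j = #{a ∈ ℤ_{p^m}^* : a ≡ 1 (mod p^j)}
  congruentUnits : ℕ → ℕ → ℕ
  congruentUnits m zero    = φ (p ^ m)
  congruentUnits m (suc j) = p ^ (m ∸ suc j)

  term : (m u s r : ℕ) → ℕ → ℕ
  term m u s r j = 𝟙 (u ≤? j) * (w j * congruentUnits m j ^ s * (p ^ (m ∸ j)) ^ r)

  positive-term : ∀ m' s' r j → j ≤ m' →
    w (suc j) * congruentUnits (suc m') (suc j) ^ suc s' * (p ^ (m' ∸ j)) ^ r ≡ φ (p ^ suc m') * (p ^ (m' ∸ j)) ^ (s' + r)
  positive-term m' s' r j j≤m' = begin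
    p ^ j * (p ∸ 1) * (q * q ^ s') * q ^ r  ≡⟨ solve 5 (λ a b c x y → a :* b :* (c :* x) :* y := (a :* c) :* b :* (x :* y)) refl (p ^ j) (p ∸ 1) q (q ^ s') (q ^ r) ⟩
    p ^ j * q * (p ∸ 1) * (q ^ s' * q ^ r)  ≡⟨ cong₂ (λ a b → a * (p ∸ 1) * b) pʲq≡pᵐ (sym (^-distribˡ-+-* q s' r)) ⟩
    p ^ m' * (p ∸ 1) * q ^ (s' + r)         ≡⟨ cong (_* q ^ (s' + r)) (sym (φ-pow m')) ⟩
    φ (p ^ suc m') * q ^ (s' + r)           ∎
    where
    open +-*-Solver
    q = p ^ (m' ∸ j)
    pʲq≡pᵐ : p ^ j * q ≡ p ^ m'
    pʲq≡pᵐ = trans (sym (^-distribˡ-+-* p j (m' ∸ j))) (cong (p ^_) (m+[n∸m]≡n j≤m'))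

  positive-terms : ∀ m' s' r (keep : ℕ → ℕ) →
    Σℕ (suc m') (λ j → keep j * (w (suc j) * congruentUnits (suc m') (suc j) ^ suc s' * (p ^ (m' ∸ j)) ^ r))
      ≡ Σℕ (suc m') (λ i → keep (m' ∸ i) * (φ (p ^ suc m') * (p ^ i) ^ (s' + r)))
  positive-terms m' s' r keep = begin
    Σℕ (suc m') (λ j → keep j * (w (suc j) * congruentUnits (suc m') (suc j) ^ suc s' * (p ^ (m' ∸ j)) ^ r))
      ≡⟨ Σℕ-cong (suc m') (λ j j<m → cong (keep j *_) (positive-term m' s' r j (≤-pred j<m))) ⟩
    Σℕ (suc m') (λ j → keep j * (F * (p ^ (m' ∸ j)) ^ K))
      ≡⟨ Σℕ-rev (suc m') _ ⟩
    Σℕ (suc m') (λ i → keep (m' ∸ i) * (F * (p ^ (m' ∸ (m' ∸ i))) ^ K))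
      ≡⟨ Σℕ-cong (suc m') (λ i i<m → cong (λ z → keep (m' ∸ i) * (F * (p ^ z) ^ K)) (m∸[m∸n]≡n (≤-pred i<m))) ⟩
    Σℕ (suc m') (λ i → keep (m' ∸ i) * (F * (p ^ i) ^ K)) ∎
    where
    F = φ (p ^ suc m')
    K = s' + r

  sum-terms-positive : ∀ m' u' s' r → u' ≤ m' →
    Σℕ (suc (suc m')) (term (suc m') (suc u') (suc s') r)
      ≡ φ (p ^ suc m') * σ (suc s' + r ∸ 1) (p ^ (suc m' ∸ suc u'))
  sum-terms-positive m' u' s' r u'≤m' = begin
    Σℕ (suc m) T                                         ≡⟨ Σℕ-cons m T ⟩
    T 0 + Σℕ m (λ j → T (suc j))                         ≡⟨ cong (_+ Σℕ m (λ j → T (suc j))) (cong (_* (w 0 * congruentUnits m 0 ^ suc s' * (p ^ m) ^ r)) (𝟙-no (suc u' ≤? 0) (λ ()))) ⟩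
    Σℕ m (λ j → T (suc j))                               ≡⟨ positive-terms m' s' r (λ j → 𝟙 (suc u' ≤? suc j)) ⟩
    Σℕ m (λ i → 𝟙 (suc u' ≤? suc (m' ∸ i)) * (F * G i))  ≡⟨ Σℕ-cong m (λ i i<m → cong (_* (F * G i)) (window i (≤-pred i<m))) ⟩
    Σℕ m (λ i → 𝟙 (i <? suc (m' ∸ u')) * (F * G i))      ≡⟨ cong (λ n → Σℕ n (λ i → 𝟙 (i <? suc (m' ∸ u')) * (F * G i))) (sym (cong suc (m∸n+n≡m u'≤m'))) ⟩
    Σℕ (suc (m' ∸ u') + u') (λ i → 𝟙 (i <? suc (m' ∸ u')) * (F * G i)) ≡⟨ Σℕ-prefix (suc (m' ∸ u')) u' _ ⟩
    Σℕ (suc (m' ∸ u')) (λ i → F * G i)                   ≡⟨ Σℕ-*ˡ (suc (m' ∸ u')) F G ⟩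
    F * Σℕ (suc (m' ∸ u')) G                             ≡⟨ cong (F *_) (sym (σ-pow K (m' ∸ u'))) ⟩
    F * σ K (p ^ (m' ∸ u'))                              ∎
    where
    m = suc m'
    K = s' + r
    F = φ (p ^ m)
    G = λ i → (p ^ i) ^ K
    T = term m (suc u') (suc s') r
    window : ∀ i → i ≤ m' → 𝟙 (suc u' ≤? suc (m' ∸ i)) ≡ 𝟙 (i <? suc (m' ∸ u'))
    window i i≤m' = 𝟙-cong (suc u' ≤? suc (m' ∸ i)) (i <? suc (m' ∸ u'))
      (λ h → s≤s (subst (_≤ m' ∸ u') (m∸[m∸n]≡n i≤m') (∸-monoʳ-≤ m' (≤-pred h))))
      (λ h → s≤s (subst (_≤ m' ∸ i) (m∸[m∸n]≡n u'≤m') (∸-monoʳ-≤ m' (≤-pred h))))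

  sum-terms-zero : ∀ m' s' r →
    Σℕ (suc (suc m')) (term (suc m') 0 (suc s') r)
      ≡ φ (p ^ suc m') * ((φ (p ^ suc m') ^ (suc s' ∸ 1)) * p ^ (suc m' * r) + σ (suc s' + r ∸ 1) (p ^ suc m') ∸ p ^ (suc m' * (suc s' + r ∸ 1)))
  sum-terms-zero m' s' r = begin
    Σℕ (suc m) T                                   ≡⟨ Σℕ-cons m T ⟩
    T 0 + Σℕ m (λ j → T (suc j))                   ≡⟨ cong₂ _+_ first (positive-terms m' s' r (λ j → 𝟙 (0 ≤? suc j))) ⟩
    F ^ suc s' * X + Σℕ m (λ i → 1 * (F * G i))    ≡⟨ cong (F ^ suc s' * X +_) (trans (Σℕ-cong m (λ i _ → *-identityˡ _)) (Σℕ-*ˡ m F G)) ⟩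
    F * F ^ s' * X + F * Σℕ m G                    ≡⟨ cong (_+ F * Σℕ m G) (*-assoc F (F ^ s') X) ⟩
    F * (F ^ s' * X) + F * Σℕ m G                  ≡⟨ sym (*-distribˡ-+ F (F ^ s' * X) (Σℕ m G)) ⟩
    F * (F ^ s' * X + Σℕ m G)                      ≡⟨ cong (F *_) (sym (m+n∸n≡m (F ^ s' * X + Σℕ m G) Z)) ⟩
    F * (F ^ s' * X + Σℕ m G + Z ∸ Z)              ≡⟨ cong (λ z → F * (z ∸ Z)) (+-assoc (F ^ s' * X) (Σℕ m G) Z) ⟩
    F * (F ^ s' * X + (Σℕ m G + Z) ∸ Z)            ≡⟨ cong (λ z → F * (F ^ s' * X + z ∸ Z)) σ-split ⟩
    F * (F ^ s' * X + σ K (p ^ m) ∸ Z)             ∎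
    where
    m = suc m'
    K = s' + r
    F = φ (p ^ m)
    G = λ i → (p ^ i) ^ K
    X = p ^ (m * r)
    Z = p ^ (m * K)
    T = term m 0 (suc s') r
    first : T 0 ≡ F ^ suc s' * X
    first = begin
      1 * (1 * F ^ suc s' * (p ^ m) ^ r) ≡⟨ *-identityˡ _ ⟩
      1 * F ^ suc s' * (p ^ m) ^ r       ≡⟨ cong₂ _*_ (*-identityˡ (F ^ suc s')) (^-*-assoc p m r) ⟩
      F ^ suc s' * X                     ∎
    σ-split : Σℕ m G + Z ≡ σ K (p ^ m)
    σ-split = trans (cong (Σℕ m G +_) (sym (^-*-assoc p m K))) (sym (σ-pow K m))

module RingSum {c ℓ : Level} (R : CommutativeRing c ℓ) where

  open CommutativeRing R hiding (zero)
  open import Defs using (ι; sumL; sumTuples; prodFin)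
  open import Relation.Binary.Reasoning.Setoid setoid
  open import Algebra.Properties.Semiring.Mult semiring using (×-homo-+; ×1-homo-*)
    renaming (_×_ to _×ₙ_)
  open import Algebra.Properties.CommutativeSemigroup *-commutativeSemigroup using (interchange)
  open import Data.Nat as ℕ using (ℕ; zero; suc; _<_)
  import Data.Nat.Properties as ℕP
  open import Data.Fin using (Fin; zero; suc)
  open import Data.Vec using (Vec; []; _∷_; lookup)
  open import Data.List as List using (List; []; _∷_; upTo; _++_; [_]; filter; tabulate)
  open import Data.List.Properties using (upTo-∷ʳ)
  open import Relation.Binary.PropositionalEquality as ≡ using (_≡_)
  open import Relation.Nullary using (yes; no)
  open import Relation.Unary using (Pred; Decidable)
  open Indicator
  open NatSum using (Σℕ)

  ιR : ℕ → Carrier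
  ιR = ι R

  -- ι is the standard map n ↦ n ×ₙ 1#, hence a semiring homomorphism
  ι≡× : ∀ n → ιR n ≡ n ×ₙ 1#
  ι≡× zero    = ≡.refl
  ι≡× (suc n) = ≡.cong (1# +_) (ι≡× n)

  ι-+ : ∀ a b → ιR (a ℕ.+ b) ≈ ιR a + ιR b
  ι-+ a b = begin
    ιR (a ℕ.+ b)        ≡⟨ ι≡× (a ℕ.+ b) ⟩
    (a ℕ.+ b) ×ₙ 1#      ≈⟨ ×-homo-+ 1# a b ⟩
    a ×ₙ 1# + b ×ₙ 1#     ≡⟨ ≡.cong₂ _+_ (≡.sym (ι≡× a)) (≡.sym (ι≡× b)) ⟩
    ιR a + ιR b         ∎

  ι-* : ∀ a b → ιR (a ℕ.* b) ≈ ιR a * ιR b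
  ι-* a b = begin
    ιR (a ℕ.* b)        ≡⟨ ι≡× (a ℕ.* b) ⟩
    (a ℕ.* b) ×ₙ 1#      ≈⟨ ×1-homo-* a b ⟩
    a ×ₙ 1# * (b ×ₙ 1#)   ≡⟨ ≡.cong₂ _*_ (≡.sym (ι≡× a)) (≡.sym (ι≡× b)) ⟩
    ιR a * ιR b         ∎

  ι1 : ιR 1 ≈ 1#
  ι1 = +-identityʳ 1#

  ΣR : ℕ → (ℕ → Carrier) → Carrier
  ΣR zero    f = 0#
  ΣR (suc n) f = ΣR n f + f n

  ΣR-cong : ∀ n {f g : ℕ → Carrier} → (∀ x → x < n → f x ≈ g x) → ΣR n f ≈ ΣR n g
  ΣR-cong zero    h = refl
  ΣR-cong (suc n) h = +-cong (ΣR-cong n (λ x x<n → h x (ℕP.m<n⇒m<1+n x<n))) (h n (ℕP.n<1+n n))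

  ΣR-zero : ∀ n (f : ℕ → Carrier) → (∀ x → x < n → f x ≈ 0#) → ΣR n f ≈ 0#
  ΣR-zero zero    f h = refl
  ΣR-zero (suc n) f h =
    trans (+-cong (ΣR-zero n f (λ x x<n → h x (ℕP.m<n⇒m<1+n x<n))) (h n (ℕP.n<1+n n))) (+-identityʳ 0#)

  ι-Σ : ∀ n f → ιR (Σℕ n f) ≈ ΣR n (λ x → ιR (f x))
  ι-Σ zero    f = refl
  ι-Σ (suc n) f = trans (ι-+ (Σℕ n f) (f n)) (+-cong (ι-Σ n f) refl)

  ΣR-+ : ∀ n f g → ΣR n (λ x → f x + g x) ≈ ΣR n f + ΣR n g
  ΣR-+ zero    f g = sym (+-identityʳ _)
  ΣR-+ (suc n) f g = trans (+-cong (ΣR-+ n f g) refl) (+-interchange _ _ _ _)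
    where open import Algebra.Properties.CommutativeSemigroup +-commutativeSemigroup
            renaming (interchange to +-interchange)

  ΣR-*ˡ : ∀ n a f → ΣR n (λ x → a * f x) ≈ a * ΣR n f
  ΣR-*ˡ zero    a f = sym (zeroʳ a)
  ΣR-*ˡ (suc n) a f = trans (+-cong (ΣR-*ˡ n a f) refl) (sym (distribˡ a _ _))

  ΣR-*ʳ : ∀ n a f → ΣR n f * a ≈ ΣR n (λ x → f x * a)
  ΣR-*ʳ n a f = trans (*-comm _ a) (trans (sym (ΣR-*ˡ n a f)) (ΣR-cong n (λ x _ → *-comm a (f x))))

  ΣR-swap : ∀ n k (f : ℕ → ℕ → Carrier) →
    ΣR n (λ x → ΣR k (λ i → f x i)) ≈ ΣR k (λ i → ΣR n (λ x → f x i))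
  ΣR-swap zero    k f = sym (ΣR-zero k _ (λ _ _ → refl))
  ΣR-swap (suc n) k f = trans (+-cong (ΣR-swap n k f) refl) (sym (ΣR-+ k (λ i → ΣR n (λ x → f x i)) (f n)))

  ΣR-point : ∀ n c (g : ℕ → Carrier) → c < n → ΣR n (λ y → ιR (𝟙 (y ℕ.≟ c)) * g y) ≈ g c
  ΣR-point (suc n) c g c<sn with n ℕ.≟ c
  ... | yes ≡.refl = begin
    ΣR n (λ y → ιR (𝟙 (y ℕ.≟ n)) * g y) + ιR 1 * g n ≈⟨ +-cong (ΣR-zero n _ off-diagonal) (*-cong ι1 refl) ⟩
    0# + 1# * g n                                     ≈⟨ +-identityˡ _ ⟩
    1# * g n                                          ≈⟨ *-identityˡ _ ⟩
    g n                                               ∎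
    where
    off-diagonal : ∀ y → y < n → ιR (𝟙 (y ℕ.≟ n)) * g y ≈ 0#
    off-diagonal y y<n = trans (*-cong (reflexive (≡.cong ιR (𝟙-no (y ℕ.≟ n) (ℕP.<⇒≢ y<n)))) refl) (zeroˡ _)
  ... | no n≢c = trans (+-cong (ΣR-point n c g (ℕP.≤∧≢⇒< (ℕP.≤-pred c<sn) (λ e → n≢c (≡.sym e)))) (zeroˡ _))
                       (+-identityʳ _)

  sL : List ℕ → (ℕ → Carrier) → Carrier
  sL = sumL R

  sL-cong : ∀ xs {f g : ℕ → Carrier} → (∀ x → f x ≈ g x) → sL xs f ≈ sL xs g
  sL-cong []       h = refl
  sL-cong (x ∷ xs) h = +-cong (h x) (sL-cong xs h)

  sL-++ : ∀ xs ys f → sL (xs ++ ys) f ≈ sL xs f + sL ys f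
  sL-++ []       ys f = sym (+-identityˡ _)
  sL-++ (x ∷ xs) ys f = trans (+-cong refl (sL-++ xs ys f)) (sym (+-assoc _ _ _))

  sL-upTo : ∀ n f → sL (upTo n) f ≈ ΣR n f
  sL-upTo zero    f = refl
  sL-upTo (suc n) f = begin
    sL (upTo (suc n)) f        ≡⟨ ≡.cong (λ l → sL l f) (≡.sym (upTo-∷ʳ n)) ⟩
    sL (upTo n ++ [ n ]) f     ≈⟨ sL-++ (upTo n) [ n ] f ⟩
    sL (upTo n) f + (f n + 0#) ≈⟨ +-cong (sL-upTo n f) (+-identityʳ _) ⟩
    ΣR n f + f n               ∎

  sL-filter : {P : Pred ℕ Level.zero} (P? : Decidable P) → ∀ xs f →
    sL (filter P? xs) f ≈ sL xs (λ x → ιR (𝟙 (P? x)) * f x)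
  sL-filter P? []       f = refl
  sL-filter P? (x ∷ xs) f with P? x
  ... | yes _ = +-cong (sym (trans (*-cong ι1 refl) (*-identityˡ _))) (sL-filter P? xs f)
  ... | no _  = trans (sL-filter P? xs f) (sym (trans (+-cong (zeroˡ _) refl) (+-identityˡ _)))

  sL-*ˡ : ∀ xs a f → sL xs (λ x → a * f x) ≈ a * sL xs f
  sL-*ˡ []       a f = sym (zeroʳ a)
  sL-*ˡ (x ∷ xs) a f = trans (+-cong refl (sL-*ˡ xs a f)) (sym (distribˡ a _ _))

  sL-*ʳ : ∀ xs a f → sL xs (λ x → f x * a) ≈ sL xs f * a
  sL-*ʳ xs a f = trans (sL-cong xs (λ x → *-comm (f x) a)) (trans (sL-*ˡ xs a f) (*-comm a _))

  sL-ΣR : ∀ xs n (f : ℕ → ℕ → Carrier) →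
    sL xs (λ x → ΣR n (λ j → f x j)) ≈ ΣR n (λ j → sL xs (λ x → f x j))
  sL-ΣR []       n f = sym (ΣR-zero n _ (λ _ _ → refl))
  sL-ΣR (x ∷ xs) n f = trans (+-cong refl (sL-ΣR xs n f)) (sym (ΣR-+ n (f x) (λ j → sL xs (λ y → f y j))))

  sT : List ℕ → (k : ℕ) → (Vec ℕ k → Carrier) → Carrier
  sT = sumTuples R

  sT-cong : ∀ xs k {f g : Vec ℕ k → Carrier} → (∀ v → f v ≈ g v) → sT xs k f ≈ sT xs k g
  sT-cong xs zero    h = h []
  sT-cong xs (suc k) h = sL-cong xs (λ x → sT-cong xs k (λ v → h (x ∷ v)))

  sT-*ˡ : ∀ xs k a f → sT xs k (λ v → a * f v) ≈ a * sT xs k f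
  sT-*ˡ xs zero    a f = refl
  sT-*ˡ xs (suc k) a f = trans (sL-cong xs (λ x → sT-*ˡ xs k a (λ v → f (x ∷ v)))) (sL-*ˡ xs a _)

  sT-*ʳ : ∀ xs k a f → sT xs k (λ v → f v * a) ≈ sT xs k f * a
  sT-*ʳ xs k a f = trans (sT-cong xs k (λ v → *-comm (f v) a)) (trans (sT-*ˡ xs k a f) (*-comm a _))

  sT-ΣR : ∀ xs k n (f : Vec ℕ k → ℕ → Carrier) →
    sT xs k (λ v → ΣR n (λ j → f v j)) ≈ ΣR n (λ j → sT xs k (λ v → f v j))
  sT-ΣR xs zero    n f = refl
  sT-ΣR xs (suc k) n f = trans (sL-cong xs (λ x → sT-ΣR xs k n (λ v → f (x ∷ v)))) (sL-ΣR xs n _)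

  pF : (k : ℕ) → (Fin k → Carrier) → Carrier
  pF = prodFin R

  -- prodFin is a fold over allFin = tabulate id; unfold one factor
  private
    foldFin : ∀ {A : Set c} (n : ℕ) → (Fin n → A → A) → A → A
    foldFin zero    H e = e
    foldFin (suc n) H e = H zero (foldFin n (λ i → H (suc i)) e)

    foldr-tabulate : ∀ {A : Set c} {k} n (g : Fin n → Fin k) (F : Fin k → A → A) e →
      List.foldr F e (tabulate g) ≡ foldFin n (λ i → F (g i)) e
    foldr-tabulate zero    g F e = ≡.refl
    foldr-tabulate (suc n) g F e = ≡.cong (F (g zero)) (foldr-tabulate n (λ i → g (suc i)) F e)

  pF-suc : ∀ k f → pF (suc k) f ≈ f zero * pF k (λ i → f (suc i))
  pF-suc k f = reflexive (≡.trans (foldr-tabulate (suc k) (λ i → i) (λ i acc → f i * acc) 1#)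
    (≡.cong (f zero *_) (≡.sym (foldr-tabulate k (λ i → i) (λ i acc → f (suc i) * acc) 1#))))

  pF-cong : ∀ k {f g : Fin k → Carrier} → (∀ i → f i ≈ g i) → pF k f ≈ pF k g
  pF-cong zero    h = refl
  pF-cong (suc k) {f} {g} h =
    trans (pF-suc k f) (trans (*-cong (h zero) (pF-cong k (λ i → h (suc i)))) (sym (pF-suc k g)))

  pF-* : ∀ k f g → pF k f * pF k g ≈ pF k (λ i → f i * g i)
  pF-* zero    f g = *-identityˡ 1#
  pF-* (suc k) f g = begin
    pF (suc k) f * pF (suc k) g                                              ≈⟨ *-cong (pF-suc k f) (pF-suc k g) ⟩
    (f zero * pF k (λ i → f (suc i))) * (g zero * pF k (λ i → g (suc i)))  ≈⟨ interchange _ _ _ _ ⟩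
    (f zero * g zero) * (pF k (λ i → f (suc i)) * pF k (λ i → g (suc i)))  ≈⟨ *-cong refl (pF-* k _ _) ⟩
    (f zero * g zero) * pF k (λ i → f (suc i) * g (suc i))                 ≈⟨ sym (pF-suc k _) ⟩
    pF (suc k) (λ i → f i * g i)                                             ∎

  pF-zero : ∀ k f (i : Fin k) → f i ≈ 0# → pF k f ≈ 0#
  pF-zero (suc k) f zero    h = trans (pF-suc k f) (trans (*-cong h refl) (zeroˡ _))
  pF-zero (suc k) f (suc i) h =
    trans (pF-suc k f) (trans (*-cong refl (pF-zero k (λ i → f (suc i)) i h)) (zeroʳ _))

  pF-const : ∀ k n → pF k (λ _ → ιR n) ≈ ιR (n ℕ.^ k)
  pF-const zero    n = sym ι1
  pF-const (suc k) n = trans (pF-suc k _) (trans (*-cong refl (pF-const k n)) (sym (ι-* n (n ℕ.^ k))))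

  sT-prod : ∀ xs k (f : Fin k → ℕ → Carrier) →
    sT xs k (λ v → pF k (λ i → f i (lookup v i))) ≈ pF k (λ i → sL xs (f i))
  sT-prod xs zero    f = refl
  sT-prod xs (suc k) f = begin
    sL xs (λ x → sT xs k (λ v → pF (suc k) (λ i → f i (lookup (x ∷ v) i))))
      ≈⟨ sL-cong xs (λ x → sT-cong xs k (λ v → pF-suc k _)) ⟩
    sL xs (λ x → sT xs k (λ v → f zero x * pF k (λ i → f (suc i) (lookup v i))))
      ≈⟨ sL-cong xs (λ x → sT-*ˡ xs k (f zero x) _) ⟩
    sL xs (λ x → f zero x * sT xs k (λ v → pF k (λ i → f (suc i) (lookup v i))))
      ≈⟨ sL-cong xs (λ x → *-cong refl (sT-prod xs k (λ i → f (suc i)))) ⟩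
    sL xs (λ x → f zero x * pF k (λ i → sL xs (f (suc i))))
      ≈⟨ sL-*ʳ xs _ (f zero) ⟩
    sL xs (f zero) * pF k (λ i → sL xs (f (suc i)))
      ≈⟨ sym (pF-suc k _) ⟩
    pF (suc k) (λ i → sL xs (f i)) ∎

module Modular (N : ℕ) {{N-nonZero : NonZero N}} (1<N : 1 < N) where

  open import Data.Nat
  open import Data.Nat.Properties
  open import Data.Nat.DivMod
  open import Data.Nat.Divisibility
  open import Data.Nat.GCD
  open import Data.Nat.Coprimality using (coprime-Bézout; gcd≡1⇒coprime)
  open import Data.Nat.Solver using (module +-*-Solver)
  open import Relation.Binary.PropositionalEquality
  open import Data.Product using (Σ; _,_)
  open +-*-Solver
  open ≡-Reasoning

  %-absorbʳ : ∀ a b → (a * (b % N)) % N ≡ (a * b) % N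
  %-absorbʳ a b = begin
    (a * (b % N)) % N               ≡⟨ %-distribˡ-* a (b % N) N ⟩
    ((a % N) * (b % N % N)) % N     ≡⟨ cong (λ z → ((a % N) * z) % N) (m%n%n≡m%n b N) ⟩
    ((a % N) * (b % N)) % N         ≡⟨ sym (%-distribˡ-* a b N) ⟩
    (a * b) % N                     ∎

  %-absorbˡ : ∀ a b → ((a % N) * b) % N ≡ (a * b) % N
  %-absorbˡ a b = trans (cong (_% N) (*-comm (a % N) b)) (trans (%-absorbʳ b a) (cong (_% N) (*-comm b a)))

  minus-one-squared : ((N ∸ 1) * (N ∸ 1)) % N ≡ 1
  minus-one-squared = square N 1<N
    where
    square : ∀ M .{{_ : NonZero M}} → 1 < M → ((M ∸ 1) * (M ∸ 1)) % M ≡ 1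
    square (suc zero)    (s≤s ())
    square (suc (suc n)) _ = trans (cong (_% suc (suc n)) expand) ([m+kn]%n≡m%n 1 n (suc (suc n)))
      where
      expand : suc n * suc n ≡ 1 + n * suc (suc n)
      expand = solve 1 (λ n → (con 1 :+ n) :* (con 1 :+ n) := con 1 :+ n :* (con 2 :+ n)) refl n

  inverse : ∀ a → gcd a N ≡ 1 → Σ ℕ (λ a' → (a * a') % N ≡ 1)
  inverse a g with coprime-Bézout (gcd≡1⇒coprime g)
  ... | Bézout.+- x y eq = x , (begin
    (a * x) % N        ≡⟨ cong (_% N) (*-comm a x) ⟩
    (x * a) % N        ≡⟨ cong (_% N) (sym eq) ⟩
    (1 + y * N) % N    ≡⟨ [m+kn]%n≡m%n 1 y N ⟩
    1 % N              ≡⟨ m<n⇒m%n≡m 1<N ⟩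
    1                  ∎)
  ... | Bézout.-+ x y eq = x * (N ∸ 1) , (begin
    (a * (x * (N ∸ 1))) % N           ≡⟨ cong (_% N) (solve 3 (λ a x n → a :* (x :* n) := (x :* a) :* n) refl a x (N ∸ 1)) ⟩
    ((x * a) * (N ∸ 1)) % N           ≡⟨ sym (%-absorbˡ (x * a) (N ∸ 1)) ⟩
    (((x * a) % N) * (N ∸ 1)) % N     ≡⟨ cong (λ z → (z * (N ∸ 1)) % N) xa≡-1 ⟩
    ((N ∸ 1) * (N ∸ 1)) % N           ≡⟨ minus-one-squared ⟩
    1                                 ∎)
    where
    -- 1 + x a = y N, so x a ≡ -1
    xa≡-1 : (x * a) % N ≡ N ∸ 1
    xa≡-1 = %-pred-≡0 {x * a} {N} (trans (cong (_% N) eq) (m*n%n≡0 y N))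

  solve-for : ∀ a a' x y → (a * a') % N ≡ 1 → x < N → y ≡ (a * x) % N → x ≡ (a' * y) % N
  solve-for a a' x y aa'≡1 x<N refl = sym (begin
    (a' * ((a * x) % N)) % N          ≡⟨ %-absorbʳ a' (a * x) ⟩
    (a' * (a * x)) % N                ≡⟨ cong (_% N) (solve 3 (λ a a' x → a' :* (a :* x) := (a :* a') :* x) refl a a' x) ⟩
    ((a * a') * x) % N                ≡⟨ sym (%-absorbˡ (a * a') x) ⟩
    (((a * a') % N) * x) % N          ≡⟨ cong (λ z → (z * x) % N) aa'≡1 ⟩
    (1 * x) % N                       ≡⟨ cong (_% N) (*-identityˡ x) ⟩
    x % N                             ≡⟨ m<n⇒m%n≡m x<N ⟩
    x                                 ∎)

  solve-for′ : ∀ a a' x y → (a * a') % N ≡ 1 → y < N → x ≡ (a' * y) % N → y ≡ (a * x) % N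
  solve-for′ a a' x y aa'≡1 = solve-for a' a y x (trans (cong (_% N) (*-comm a' a)) aa'≡1)

  ∣⇒%≡1 : ∀ d .{{_ : NonZero d}} y → 1 ≤ y → d ∣ y ∸ 1 → y % d ≡ 1 % d
  ∣⇒%≡1 d (suc y) _ (divides q refl) = [m+kn]%n≡m%n 1 q d

  %≡1⇒∣ : ∀ d .{{_ : NonZero d}} y → y % d ≡ 1 % d → d ∣ y ∸ 1
  %≡1⇒∣ (suc zero)      y _ = divides (y ∸ 1) (sym (*-identityʳ _))
  %≡1⇒∣ d@(suc (suc k)) y e =
    divides (y / d) (cong (_∸ 1) (trans (m≡m%n+[m/n]*n y d) (cong (_+ (y / d) * d) e)))

  mul-preserves-residue : ∀ d .{{_ : NonZero d}} → d ∣ N → ∀ a x → a % d ≡ 1 % d → ((a * x) % N) % d ≡ x % d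
  mul-preserves-residue d d∣N a x e = begin
    ((a * x) % N) % d          ≡⟨ m∣n⇒o%n%m≡o%m d N (a * x) d∣N ⟩
    (a * x) % d                ≡⟨ %-distribˡ-* a x d ⟩
    ((a % d) * (x % d)) % d    ≡⟨ cong (λ z → (z * (x % d)) % d) e ⟩
    ((1 % d) * (x % d)) % d    ≡⟨ sym (%-distribˡ-* 1 x d) ⟩
    (1 * x) % d                ≡⟨ cong (_% d) (*-identityˡ x) ⟩
    x % d                      ∎

module UnitsModPrimePower (p : ℕ) (pr : Prime p) (m : ℕ) (1≤m : 1 ≤ m) where

  open import Data.Nat
  open import Data.Nat.Primality using (euclidsLemma)
  open import Data.Nat.DivMod using (_%_)
  open import Data.Nat.Divisibility using (_∣_; ∣n∣m%n⇒∣m)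
  open import Data.Nat.GCD using (gcd)
  open import Data.Empty using (⊥; ⊥-elim)
  open import Data.Sum using (_⊎_; inj₁; inj₂)
  open import Relation.Binary.PropositionalEquality using (_≡_)
  open PrimePower p pr

  N : ℕ
  N = p ^ m

  instance
    N-nonZero : NonZero N
    N-nonZero = pow-nonZero {m}

  1<N : 1 < N
  1<N = 1<pow m 1≤m

  open Modular N 1<N public

  unit⇒≥1 : ∀ {x} → gcd x N ≡ 1 → 1 ≤ x
  unit⇒≥1 {zero}  u = ⊥-elim (0-nonunit m 1≤m u)
  unit⇒≥1 {suc x} u = s≤s z≤n

  unit-% : ∀ {x} → gcd x N ≡ 1 → gcd (x % N) N ≡ 1
  unit-% {x} u = ¬p∣⇒unit {x % N} {m} (λ h → unit⇒¬p∣ {x} {m} 1≤m u (∣n∣m%n⇒∣m (p∣pow m 1≤m) h))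

  unit-* : ∀ {a x} → gcd a N ≡ 1 → gcd x N ≡ 1 → gcd ((a * x) % N) N ≡ 1
  unit-* {a} {x} ua ux = ¬p∣⇒unit {(a * x) % N} {m} λ h →
    p∤-either (euclidsLemma a x pr (∣n∣m%n⇒∣m (p∣pow m 1≤m) h))
    where
    p∤-either : p ∣ a ⊎ p ∣ x → ⊥
    p∤-either (inj₁ h) = unit⇒¬p∣ {a} {m} 1≤m ua h
    p∤-either (inj₂ h) = unit⇒¬p∣ {x} {m} 1≤m ux h

module GcdExpansion {c ℓ : Level} (R : CommutativeRing c ℓ) (p : ℕ) (pr : Prime p) (m : ℕ) where

  open import Defs using (gcdList; DirichletCharacter; χ; units; residues; Ssum)
  open CommutativeRing R hiding (zero)
  open import Relation.Binary.Reasoning.Setoid setoid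
  open import Data.Nat as ℕ using (suc; _^_; _∸_)
  open import Data.Nat.Properties using (≤-pred)
  open import Data.Nat.Divisibility using (_∣_; _∣?_; ∣-refl; ∣-trans)
  open import Data.Nat.GCD using (gcd; gcd[m,n]∣m; gcd[m,n]∣n; gcd-greatest)
  open import Data.Fin using (Fin)
  open import Data.Vec as Vec using (Vec; []; _∷_; lookup)
  open import Data.Vec.Properties using (lookup-map)
  open import Data.List as List using (List; []; _∷_; _++_)
  open import Relation.Binary.PropositionalEquality as ≡ using (_≡_)
  open Indicator
  open NatSum using (Σℕ)
  open PrimePower p pr
  open RingSum R

  N : ℕ
  N = p ^ m

  restrictedSum : DirichletCharacter R N → ℕ → Carrier
  restrictedSum ch j = sL (units R N) (λ a → ιR (𝟙 (p ^ j ∣? a ∸ 1)) * χ ch a)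

  multipleCount : ℕ → Carrier
  multipleCount j = sL (residues R N) (λ b → ιR (𝟙 (p ^ j ∣? b)))

  multipleCount-value : ∀ j → j ℕ.≤ m → multipleCount j ≈ ιR (p ^ (m ∸ j))
  multipleCount-value j j≤m =
    trans (sL-upTo N _) (trans (sym (ι-Σ N _)) (reflexive (≡.cong ιR (count-multiples m j j≤m))))

  allDivisible : ℕ → List ℕ → Carrier
  allDivisible j zs = List.foldr (λ z acc → ιR (𝟙 (p ^ j ∣? z)) * acc) 1# zs

  gcdList∣N : ∀ zs → gcdList zs N ∣ N
  gcdList∣N []       = ∣-refl
  gcdList∣N (z ∷ zs) = ∣-trans (gcd[m,n]∣n z _) (gcdList∣N zs)

  divides-gcdList : ∀ j → j ℕ.≤ m → ∀ zs → ιR (𝟙 (p ^ j ∣? gcdList zs N)) ≈ allDivisible j zs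
  divides-gcdList j j≤m []       = trans (reflexive (≡.cong ιR (𝟙-yes (p ^ j ∣? N) (pow∣pow j≤m)))) ι1
  divides-gcdList j j≤m (z ∷ zs) = begin
    ιR (𝟙 (d ∣? gcd z g))                  ≡⟨ ≡.cong ιR (≡.sym (𝟙-∧ (d ∣? z) (d ∣? g) (d ∣? gcd z g) gcd-greatest
                                                (λ h → ∣-trans h (gcd[m,n]∣m z g)) (λ h → ∣-trans h (gcd[m,n]∣n z g)))) ⟩
    ιR (𝟙 (d ∣? z) ℕ.* 𝟙 (d ∣? g))         ≈⟨ ι-* (𝟙 (d ∣? z)) (𝟙 (d ∣? g)) ⟩
    ιR (𝟙 (d ∣? z)) * ιR (𝟙 (d ∣? g))      ≈⟨ *-cong refl (divides-gcdList j j≤m zs) ⟩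
    ιR (𝟙 (d ∣? z)) * allDivisible j zs    ∎
    where
    d = p ^ j
    g = gcdList zs N

  gcd-expansion : ∀ zs → ιR (gcdList zs N) ≈ ΣR (suc m) (λ j → ιR (w j) * allDivisible j zs)
  gcd-expansion zs = begin
    ιR g                                                 ≡⟨ ≡.cong ιR (divisor-expansion m g (gcdList∣N zs)) ⟩
    ιR (Σℕ (suc m) (λ j → w j ℕ.* 𝟙 (p ^ j ∣? g)))       ≈⟨ ι-Σ (suc m) _ ⟩
    ΣR (suc m) (λ j → ιR (w j ℕ.* 𝟙 (p ^ j ∣? g)))       ≈⟨ ΣR-cong (suc m) (λ j j<M → trans (ι-* (w j) _) (*-cong refl (divides-gcdList j (≤-pred j<M) zs))) ⟩
    ΣR (suc m) (λ j → ιR (w j) * allDivisible j zs)      ∎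
    where g = gcdList zs N

  allDivisible-++ : ∀ j xs ys → allDivisible j (xs ++ ys) ≈ allDivisible j xs * allDivisible j ys
  allDivisible-++ j []       ys = sym (*-identityˡ _)
  allDivisible-++ j (x ∷ xs) ys = trans (*-cong refl (allDivisible-++ j xs ys)) (sym (*-assoc _ _ _))

  allDivisible-vec : ∀ j {k} (v : Vec ℕ k) → allDivisible j (Vec.toList v) ≈ pF k (λ i → ιR (𝟙 (p ^ j ∣? lookup v i)))
  allDivisible-vec j []                = refl
  allDivisible-vec j {suc k} (x ∷ v)   = trans (*-cong refl (allDivisible-vec j v)) (sym (pF-suc k _))

  module _ (r s : ℕ) (chs : Fin s → DirichletCharacter R N) where

    PA : ℕ → Vec ℕ s → Carrier
    PA j a = pF s (λ i → ιR (𝟙 (p ^ j ∣? lookup a i ∸ 1)) * χ (chs i) (lookup a i))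

    PB : ℕ → Vec ℕ r → Carrier
    PB j b = pF r (λ i → ιR (𝟙 (p ^ j ∣? lookup b i)))

    term-factorises : ∀ j a b →
      ιR (w j) * allDivisible j (Vec.toList (Vec.map (_∸ 1) a) ++ Vec.toList b) * pF s (λ i → χ (chs i) (lookup a i))
        ≈ (ιR (w j) * PA j a) * PB j b
    term-factorises j a b = begin
      W * allDivisible j (Vec.toList a-1 ++ Vec.toList b) * Z   ≈⟨ *-cong (*-cong refl (allDivisible-++ j (Vec.toList a-1) (Vec.toList b))) refl ⟩
      W * (X * Y) * Z                                           ≈⟨ regroup ⟩
      (W * (X * Z)) * Y                                         ≈⟨ *-cong (*-cong refl (*-cong (allDivisible-vec j a-1) refl)) (allDivisible-vec j b) ⟩
      (W * (pF s (λ i → ιR (𝟙 (p ^ j ∣? lookup a-1 i))) * Z)) * PB j b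
        ≈⟨ *-cong (*-cong refl (pF-* s _ _)) refl ⟩
      (W * pF s (λ i → ιR (𝟙 (p ^ j ∣? lookup a-1 i)) * χ (chs i) (lookup a i))) * PB j b
        ≈⟨ *-cong (*-cong refl (pF-cong s (λ i → reflexive (≡.cong (λ z → ιR (𝟙 (p ^ j ∣? z)) * χ (chs i) (lookup a i)) (lookup-map i (_∸ 1) a))))) refl ⟩
      (W * PA j a) * PB j b                                     ∎
      where
      a-1 = Vec.map (_∸ 1) a
      W = ιR (w j)
      X = allDivisible j (Vec.toList a-1)
      Y = allDivisible j (Vec.toList b)
      Z = pF s (λ i → χ (chs i) (lookup a i))
      regroup : W * (X * Y) * Z ≈ (W * (X * Z)) * Y
      regroup = begin
        W * (X * Y) * Z     ≈⟨ *-assoc W (X * Y) Z ⟩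
        W * ((X * Y) * Z)   ≈⟨ *-cong refl (*-assoc X Y Z) ⟩
        W * (X * (Y * Z))   ≈⟨ *-cong refl (*-cong refl (*-comm Y Z)) ⟩
        W * (X * (Z * Y))   ≈⟨ *-cong refl (sym (*-assoc X Z Y)) ⟩
        W * ((X * Z) * Y)   ≈⟨ sym (*-assoc W (X * Z) Y) ⟩
        (W * (X * Z)) * Y   ∎

    S-expansion : Ssum R N r s chs
      ≈ ΣR (suc m) (λ j → ιR (w j) * pF s (λ i → restrictedSum (chs i) j) * pF r (λ _ → multipleCount j))
    S-expansion = begin
      sT U s (λ a → sT Res r (λ b → ιR (gcdList (Vec.toList (Vec.map (_∸ 1) a) ++ Vec.toList b) N) * Z a))
        ≈⟨ sT-cong U s (λ a → sT-cong Res r (λ b → expand a b)) ⟩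
      sT U s (λ a → sT Res r (λ b → ΣR M (λ j → (ιR (w j) * PA j a) * PB j b)))
        ≈⟨ sT-cong U s (λ a → sT-ΣR Res r M (λ b j → (ιR (w j) * PA j a) * PB j b)) ⟩
      sT U s (λ a → ΣR M (λ j → sT Res r (λ b → (ιR (w j) * PA j a) * PB j b)))
        ≈⟨ sT-cong U s (λ a → ΣR-cong M (λ j _ → trans (sT-*ˡ Res r _ (PB j)) (*-cong refl (sT-prod Res r (λ i b → ιR (𝟙 (p ^ j ∣? b))))))) ⟩
      sT U s (λ a → ΣR M (λ j → (ιR (w j) * PA j a) * pF r (λ _ → multipleCount j)))
        ≈⟨ sT-ΣR U s M (λ a j → (ιR (w j) * PA j a) * pF r (λ _ → multipleCount j)) ⟩
      ΣR M (λ j → sT U s (λ a → (ιR (w j) * PA j a) * pF r (λ _ → multipleCount j)))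
        ≈⟨ ΣR-cong M (λ j _ → trans (sT-*ʳ U s _ (λ a → ιR (w j) * PA j a))
             (*-cong (trans (sT-*ˡ U s (ιR (w j)) (PA j)) (*-cong refl (sT-prod U s (λ i a → ιR (𝟙 (p ^ j ∣? a ∸ 1)) * χ (chs i) a)))) refl)) ⟩
      ΣR M (λ j → ιR (w j) * pF s (λ i → restrictedSum (chs i) j) * pF r (λ _ → multipleCount j)) ∎
      where
      M = suc m
      U = units R N
      Res = residues R N
      Z = λ a → pF s (λ i → χ (chs i) (lookup a i))
      expand : ∀ a b → ιR (gcdList (Vec.toList (Vec.map (_∸ 1) a) ++ Vec.toList b) N) * Z a
                       ≈ ΣR M (λ j → (ιR (w j) * PA j a) * PB j b)
      expand a b = trans (*-cong (gcd-expansion (Vec.toList (Vec.map (_∸ 1) a) ++ Vec.toList b)) refl)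
                   (trans (ΣR-*ʳ M (Z a) _) (ΣR-cong M (λ j _ → term-factorises j a b)))

-- If every x < n satisfies P x or a fixed Q, then all x < n satisfy P, or Q.
-- (A constructive substitute for choosing a counterexample to ∀ x. P x.)
module FiniteChoice where

  open import Data.Nat using (ℕ; zero; suc; _<_)
  open import Data.Nat.Properties using (m<n⇒m<1+n; n<1+n; m≤n⇒m<n∨m≡n; ≤-pred)
  open import Data.Sum using (_⊎_; inj₁; inj₂)
  open import Relation.Binary.PropositionalEquality using (_≡_; refl)

  all-or : ∀ {a b} n (P : ℕ → Set a) (Q : Set b) →
    (∀ x → x < n → P x ⊎ Q) → (∀ x → x < n → P x) ⊎ Q
  all-or zero    P Q h = inj₁ (λ x ())
  all-or (suc n) P Q h with all-or n P Q (λ x x<n → h x (m<n⇒m<1+n x<n)) | h n (n<1+n n)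
  ... | inj₂ q   | _       = inj₂ q
  ... | inj₁ _   | inj₂ q  = inj₂ q
  ... | inj₁ all | inj₁ pn = inj₁ (λ x x<sn → extend (m≤n⇒m<n∨m≡n (≤-pred x<sn)))
    where
    extend : ∀ {x} → x < n ⊎ x ≡ n → P x
    extend (inj₁ x<n)  = all _ x<n
    extend (inj₂ refl) = pn

module IntegralDomain {c ℓ : Level} (R : CommutativeRing c ℓ) (dom : IsIntegralDomainChar0 R) where


  open CommutativeRing R
  open IsIntegralDomainChar0 dom using (noZeroDivisor)
  open import Relation.Binary.Reasoning.Setoid setoid
  open import Data.Sum using (_⊎_; inj₁; inj₂)

  fixed⇒one-or-zero : ∀ u X → X ≈ u * X → (u ≈ 1#) ⊎ (X ≈ 0#)
  fixed⇒one-or-zero u X e with noZeroDivisor (u - 1#) X [u-1]X≈0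
    where
    [u-1]X≈0 : (u - 1#) * X ≈ 0#
    [u-1]X≈0 = begin
      (u + - 1#) * X        ≈⟨ distribʳ X u (- 1#) ⟩
      u * X + - 1# * X      ≈⟨ +-cong (sym e) refl ⟩
      X + - 1# * X          ≈⟨ +-cong (sym (*-identityˡ X)) refl ⟩
      1# * X + - 1# * X     ≈⟨ sym (distribʳ X 1# (- 1#)) ⟩
      (1# + - 1#) * X       ≈⟨ *-cong (-‿inverseʳ 1#) refl ⟩
      0# * X                ≈⟨ zeroˡ X ⟩
      0#                    ∎
  ... | inj₂ X≈0   = inj₂ X≈0
  ... | inj₁ u-1≈0 = inj₁ (begin
    u                  ≈⟨ sym (+-identityʳ u) ⟩
    u + 0#             ≈⟨ +-cong refl (sym (-‿inverseˡ 1#)) ⟩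
    u + (- 1# + 1#)    ≈⟨ sym (+-assoc u (- 1#) 1#) ⟩
    (u + - 1#) + 1#    ≈⟨ +-cong u-1≈0 refl ⟩
    0# + 1#            ≈⟨ +-identityˡ 1# ⟩
    1#                 ∎)

module CharacterSum {c ℓ : Level} (R : CommutativeRing c ℓ) (dom : IsIntegralDomainChar0 R)
  (p : ℕ) (pr : Prime p) (m : ℕ) (1≤m : 1 ≤ m) where

  open import Defs using (χ; mult; vanish; periodic; units; InducedModulus)
  open CommutativeRing R hiding (zero)
  open import Relation.Binary.Reasoning.Setoid setoid
  open import Data.Nat as ℕ using (zero; suc; z≤n; s≤s; _^_; _∸_; _%_; _/_)
  import Data.Nat.Properties as ℕP
  open import Data.Nat.DivMod using (m≡m%n+[m/n]*n; m%n<n; m∣n⇒o%n%m≡o%m)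
  open import Data.Nat.Divisibility using (_∣_; _∣?_; divides; ∣-trans)
  open import Data.Nat.GCD using (gcd)
  open import Data.List using (upTo)
  open import Relation.Binary.PropositionalEquality as ≡ using (_≡_)
  open import Relation.Nullary using (Dec; yes; no)
  open import Data.Empty using (⊥-elim)
  open import Data.Sum as Sum using (_⊎_; inj₁; [_,_]′)
  open import Data.Product using (_,_)
  open Indicator
  open NatSum using (Σℕ; Σℕ-cong)
  open PrimePower p pr
  open ClosedForm p pr using (congruentUnits)
  open RingSum R
  open UnitsModPrimePower p pr m 1≤m
  open GcdExpansion R p pr m using (restrictedSum)
  open FiniteChoice
  open IntegralDomain R dom

  isUnit? : ∀ x → Dec (gcd x N ≡ 1)
  isUnit? x = gcd x N ℕ.≟ 1

  sum-over-units : ∀ f → sL (units R N) f ≈ ΣR N (λ x → ιR (𝟙 (isUnit? x)) * f x)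
  sum-over-units f = trans (sL-filter isUnit? (upTo N) f) (sL-upTo N _)

  -- multiplication by a unit a permutes ℤ_N
  reindex : ∀ a → gcd a N ≡ 1 → (G : ℕ → Carrier) → ΣR N G ≈ ΣR N (λ x → G ((a ℕ.* x) % N))
  reindex a ua G with inverse a ua
  ... | a' , aa'≡1 = sym (begin
    ΣR N (λ x → G (f x))                                 ≈⟨ ΣR-cong N (λ x _ → sym (ΣR-point N (f x) G (m%n<n (a ℕ.* x) N))) ⟩
    ΣR N (λ x → ΣR N (λ y → ιR (𝟙 (y ℕ.≟ f x)) * G y))   ≈⟨ ΣR-swap N N _ ⟩
    ΣR N (λ y → ΣR N (λ x → ιR (𝟙 (y ℕ.≟ f x)) * G y))   ≈⟨ ΣR-cong N (λ y y<N → ΣR-cong N (λ x x<N → reflexive (≡.cong (λ z → ιR z * G y) (graph x y x<N y<N)))) ⟩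
    ΣR N (λ y → ΣR N (λ x → ιR (𝟙 (x ℕ.≟ f' y)) * G y))  ≈⟨ ΣR-cong N (λ y _ → ΣR-point N (f' y) (λ _ → G y) (m%n<n (a' ℕ.* y) N)) ⟩
    ΣR N G                                               ∎)
    where
    f  = λ x → (a ℕ.* x) % N
    f' = λ y → (a' ℕ.* y) % N
    graph : ∀ x y → x ℕ.< N → y ℕ.< N → 𝟙 (y ℕ.≟ f x) ≡ 𝟙 (x ℕ.≟ f' y)
    graph x y x<N y<N = 𝟙-cong (y ℕ.≟ f x) (x ℕ.≟ f' y) (solve-for a a' x y aa'≡1 x<N) (solve-for′ a a' x y aa'≡1 y<N)

  count-restricted-units : ∀ j → j ℕ.≤ m → Σℕ N (λ x → 𝟙 (isUnit? x) ℕ.* 𝟙 (p ^ j ∣? x ∸ 1)) ≡ congruentUnits m j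
  count-restricted-units zero    _   = ≡.trans (Σℕ-cong N (λ x _ → ≡.trans (≡.cong (𝟙 (isUnit? x) ℕ.*_) (𝟙-yes (1 ∣? x ∸ 1) every≡1)) (ℕP.*-identityʳ _)))
                                               (count-units m 1≤m)
    where
    every≡1 : ∀ {y} → 1 ∣ y
    every≡1 {y} = divides y (≡.sym (ℕP.*-identityʳ y))
  count-restricted-units (suc j) j≤m = count-units≡1 m (suc j) (s≤s z≤n) j≤m

  module _ (ch : DirichletCharacter R N) where

    χ-plus-multiple : ∀ y k → χ ch (y ℕ.+ k ℕ.* N) ≈ χ ch y
    χ-plus-multiple y zero    = reflexive (≡.cong (χ ch) (ℕP.+-identityʳ y))
    χ-plus-multiple y (suc k) = trans (reflexive (≡.cong (χ ch) reassoc)) (trans (periodic ch (y ℕ.+ k ℕ.* N)) (χ-plus-multiple y k))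
      where
      reassoc : y ℕ.+ (N ℕ.+ k ℕ.* N) ≡ y ℕ.+ k ℕ.* N ℕ.+ N
      reassoc = ≡.trans (≡.cong (y ℕ.+_) (ℕP.+-comm N (k ℕ.* N))) (≡.sym (ℕP.+-assoc y (k ℕ.* N) N))

    χ-mod : ∀ x → χ ch (x % N) ≈ χ ch x
    χ-mod x = sym (trans (reflexive (≡.cong (χ ch) (m≡m%n+[m/n]*n x N))) (χ-plus-multiple (x % N) (x / N)))

    summand : ℕ → ℕ → Carrier
    summand j x = ιR (𝟙 (p ^ j ∣? x ∸ 1)) * χ ch x

    -- χ vanishes off the units, so A(j) is the full sum of the summand
    restrictedSum≈ΣR : ∀ j → restrictedSum ch j ≈ ΣR N (summand j)
    restrictedSum≈ΣR j = trans (sum-over-units (summand j)) (ΣR-cong N (λ x _ → drop-indicator x))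
      where
      drop-indicator : ∀ x → ιR (𝟙 (isUnit? x)) * summand j x ≈ summand j x
      drop-indicator x with isUnit? x
      ... | yes _ = trans (*-cong ι1 refl) (*-identityˡ _)
      ... | no nu = trans (zeroˡ _) (sym (trans (*-cong refl (vanish ch x nu)) (zeroʳ _)))

    module _ (j : ℕ) (j≤m : j ℕ.≤ m) where

      private
        d = p ^ j
        instance
          d-nonZero : ℕ.NonZero d
          d-nonZero = pow-nonZero {j}

      d∣N : d ∣ N
      d∣N = pow∣pow j≤m

      summand-twist : ∀ a → gcd a N ≡ 1 → a % d ≡ 1 % d → ∀ x → summand j ((a ℕ.* x) % N) ≈ χ ch a * summand j x
      summand-twist a ua ad x with isUnit? x
      ... | no nu = begin
        summand j ((a ℕ.* x) % N)    ≈⟨ *-cong refl (trans (χ-mod (a ℕ.* x)) (mult ch a x)) ⟩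
        _ * (χ ch a * χ ch x)        ≈⟨ *-cong refl (trans (*-cong refl (vanish ch x nu)) (zeroʳ _)) ⟩
        _ * 0#                       ≈⟨ zeroʳ _ ⟩
        0#                           ≈⟨ sym (zeroʳ _) ⟩
        χ ch a * 0#                  ≈⟨ *-cong refl (sym (trans (*-cong refl (vanish ch x nu)) (zeroʳ _))) ⟩
        χ ch a * summand j x         ∎
      ... | yes ux = begin
        ιR (𝟙 (d ∣? y ∸ 1)) * χ ch y           ≈⟨ *-cong (reflexive (≡.cong ιR same-class)) (trans (χ-mod (a ℕ.* x)) (mult ch a x)) ⟩
        ιR (𝟙 (d ∣? x ∸ 1)) * (χ ch a * χ ch x) ≈⟨ sym (*-assoc _ _ _) ⟩
        ιR (𝟙 (d ∣? x ∸ 1)) * χ ch a * χ ch x   ≈⟨ *-cong (*-comm _ _) refl ⟩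
        χ ch a * ιR (𝟙 (d ∣? x ∸ 1)) * χ ch x   ≈⟨ *-assoc _ _ _ ⟩
        χ ch a * summand j x                   ∎
        where
        y = (a ℕ.* x) % N
        uy : gcd y N ≡ 1
        uy = unit-* {a} {x} ua ux
        -- y ≡ x (mod p^j), so y ≡ 1 iff x ≡ 1
        same-class : 𝟙 (d ∣? y ∸ 1) ≡ 𝟙 (d ∣? x ∸ 1)
        same-class = 𝟙-cong (d ∣? y ∸ 1) (d ∣? x ∸ 1)
          (λ h → %≡1⇒∣ d x (≡.trans (≡.sym (mul-preserves-residue d d∣N a x ad)) (∣⇒%≡1 d y (unit⇒≥1 uy) h)))
          (λ h → %≡1⇒∣ d y (≡.trans (mul-preserves-residue d d∣N a x ad) (∣⇒%≡1 d x (unit⇒≥1 ux) h)))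

      sum-twist : ∀ a → gcd a N ≡ 1 → a % d ≡ 1 % d → ΣR N (summand j) ≈ χ ch a * ΣR N (summand j)
      sum-twist a ua ad = trans (reindex a ua (summand j))
        (trans (ΣR-cong N (λ x _ → summand-twist a ua ad x)) (ΣR-*ˡ N (χ ch a) (summand j)))

      induced-or-vanishes : InducedModulus R ch d ⊎ ΣR N (summand j) ≈ 0#
      induced-or-vanishes = Sum.map₁ induced (all-or N P Q each)
        where
        P : ℕ → Set ℓ
        P x = gcd x N ≡ 1 → x % d ≡ 1 % d → χ ch x ≈ 1#
        Q : Set ℓ
        Q = ΣR N (summand j) ≈ 0#
        each : ∀ x → x ℕ.< N → P x ⊎ Q
        each x _ with isUnit? x | x % d ℕ.≟ 1 % d
        ... | no nu  | _      = inj₁ (λ u → ⊥-elim (nu u))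
        ... | yes _  | no nd  = inj₁ (λ _ e → ⊥-elim (nd e))
        ... | yes ux | yes xd = Sum.map₁ (λ h _ _ → h) (fixed⇒one-or-zero (χ ch x) _ (sum-twist x ux xd))
        -- every unit a ≡ 1 (mod d) reduces to some x < N with the same property
        induced : (∀ x → x ℕ.< N → P x) → InducedModulus R ch d
        induced all zero     ua _ = ⊥-elim (0-nonunit m 1≤m ua)
        induced all (suc a₀) ua h = sym (trans (sym (all a' (m%n<n (suc a₀) N) (unit-% ua) a'≡1)) (χ-mod (suc a₀)))
          where
          a' = suc a₀ % N
          a'≡1 : a' % d ≡ 1 % d
          a'≡1 = ≡.trans (m∣n⇒o%n%m≡o%m d N (suc a₀) d∣N)
                         (∣⇒%≡1 d (suc a₀) (s≤s z≤n) (≡.subst (d ∣_) (ℕP.∣-∣-identityʳ a₀) h))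

    -- below the conductor exponent, A(j) = 0: p^j < p^t cannot be an induced modulus
    restrictedSum-vanishes : ∀ t j → HasConductor R ch (p ^ t) → j ℕ.< t → t ℕ.≤ m → restrictedSum ch j ≈ 0#
    restrictedSum-vanishes t j (_ , _ , minimal) j<t t≤m =
      trans (restrictedSum≈ΣR j) ([ not-induced , (λ q → q) ]′ (induced-or-vanishes j j≤m))
      where
      j≤m = ℕP.≤-trans (ℕP.<⇒≤ j<t) t≤m
      not-induced : InducedModulus R ch (p ^ j) → ΣR N (summand j) ≈ 0#
      not-induced ind = ⊥-elim (ℕP.<⇒≱ (ℕP.^-monoʳ-< p 1<p j<t) (minimal (p ^ j) (pow∣pow j≤m) ind))

    -- at or above the conductor exponent, χ = 1 on the summation range and A(j) = c_j
    restrictedSum-count : ∀ t j → HasConductor R ch (p ^ t) → t ℕ.≤ j → j ℕ.≤ m → restrictedSum ch j ≈ ιR (congruentUnits m j)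
    restrictedSum-count t j (_ , induced , _) t≤j j≤m = begin
      restrictedSum ch j                                                  ≈⟨ sum-over-units _ ⟩
      ΣR N (λ x → ιR (𝟙 (isUnit? x)) * summand j x)                       ≈⟨ ΣR-cong N (λ x _ → counted x) ⟩
      ΣR N (λ x → ιR (𝟙 (isUnit? x) ℕ.* 𝟙 (p ^ j ∣? x ∸ 1)))              ≈⟨ sym (ι-Σ N _) ⟩
      ιR (Σℕ N (λ x → 𝟙 (isUnit? x) ℕ.* 𝟙 (p ^ j ∣? x ∸ 1)))              ≡⟨ ≡.cong ιR (count-restricted-units j j≤m) ⟩
      ιR (congruentUnits m j)                                                          ∎
      where
      χ≈1 : ∀ x → gcd x N ≡ 1 → p ^ j ∣ x ∸ 1 → χ ch x ≈ 1#
      χ≈1 zero     ux _  = ⊥-elim (0-nonunit m 1≤m ux)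
      χ≈1 (suc x₀) ux dv = induced (suc x₀) ux (≡.subst (p ^ t ∣_) (≡.sym (ℕP.∣-∣-identityʳ x₀)) (∣-trans (pow∣pow t≤j) dv))
      counted : ∀ x → ιR (𝟙 (isUnit? x)) * summand j x ≈ ιR (𝟙 (isUnit? x) ℕ.* 𝟙 (p ^ j ∣? x ∸ 1))
      counted x with isUnit? x | p ^ j ∣? x ∸ 1
      ... | no _   | _      = zeroˡ _
      ... | yes _  | no _   = trans (*-cong refl (zeroˡ _)) (zeroʳ _)
      ... | yes ux | yes dv = trans (*-cong ι1 (trans (*-cong ι1 (χ≈1 x ux dv)) (*-identityˡ _))) (trans (*-identityˡ _) (sym ι1))

module Maximum where

  open import Data.Nat using (ℕ; z≤n; _⊔_; _<?_)
  open import Data.Nat.Properties using (m≤m⊔n; m≤n⇒m≤o⊔n; ⊔-lub; ≮⇒≥; <⇒≱; ≰⇒>)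
  open import Data.Fin using (Fin)
  open import Data.List using (List; []; _∷_; foldr; map; allFin)
  open import Data.List.Membership.Propositional using (_∈_)
  open import Data.List.Membership.Propositional.Properties using (∈-map⁺; ∈-allFin)
  open import Data.List.Relation.Unary.All as All using (All; []; _∷_)
  open import Data.List.Relation.Unary.All.Properties as All using ()
  open import Data.List.Relation.Unary.Any as Any using (Any; here; there)
  open import Data.List.Relation.Unary.Any.Properties as Any using ()
  open import Data.Product using (∃)
  open import Relation.Binary.PropositionalEquality using (refl)
  open import Relation.Nullary using (yes; no)
  open import Defs using (maxFin)

  ≤-max : ∀ {x xs} → x ∈ xs → x ≤ foldr _⊔_ 0 xs
  ≤-max {xs = y ∷ ys} (here refl) = m≤m⊔n y (foldr _⊔_ 0 ys)
  ≤-max {xs = y ∷ ys} (there x∈)  = m≤n⇒m≤o⊔n y (≤-max x∈)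

  max-lub : ∀ {b xs} → All (_≤ b) xs → foldr _⊔_ 0 xs ≤ b
  max-lub []       = z≤n
  max-lub (h ∷ hs) = ⊔-lub h (max-lub hs)

  below-max : ∀ {j} xs → j < foldr _⊔_ 0 xs → Any (j <_) xs
  below-max {j} (x ∷ xs) lt with j <? x
  ... | yes j<x = here j<x
  ... | no j≮x  = there (below-max xs (≰⇒> (λ max≤j → <⇒≱ lt (⊔-lub (≮⇒≥ j≮x) max≤j))))

  ≤-maxFin : ∀ s (t : Fin s → ℕ) i → t i ≤ maxFin s t
  ≤-maxFin s t i = ≤-max (∈-map⁺ t (∈-allFin i))

  maxFin-lub : ∀ s (t : Fin s → ℕ) b → (∀ i → t i ≤ b) → maxFin s t ≤ b
  maxFin-lub s t b h = max-lub (All.map⁺ (All.universal h (allFin s)))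

  below-maxFin : ∀ s (t : Fin s → ℕ) j → j < maxFin s t → ∃ (λ i → j < t i)
  below-maxFin s t j lt = Any.satisfied (Any.map⁻ (below-max (map t (allFin s)) lt))

module Evaluation {c ℓ : Level} (R : CommutativeRing c ℓ) (dom : IsIntegralDomainChar0 R)
  (p : ℕ) (pr : Prime p) (m : ℕ) (1≤m : 1 ≤ m) (r s : ℕ)
  (chs : Fin s → DirichletCharacter R (p ^ m)) (t : Fin s → ℕ)
  (t≤m : ∀ i → t i ≤ m) (conductor : ∀ i → HasConductor R (chs i) (p ^ t i)) where

  open import Defs using (maxFin; Ssum)
  open CommutativeRing R hiding (zero)
  open import Relation.Binary.Reasoning.Setoid setoid
  open import Data.Nat as ℕ using (suc; _^_; _∸_; _≤?_)
  import Data.Nat.Properties as ℕP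
  open import Relation.Binary.PropositionalEquality as ≡ using (_≡_)
  open import Relation.Nullary using (Dec; yes; no)
  open import Data.Product using (_,_)
  open Indicator
  open NatSum using (Σℕ)
  open PrimePower p pr using (w)
  open ClosedForm p pr using (congruentUnits; term)
  open RingSum R
  open GcdExpansion R p pr m
  open CharacterSum R dom p pr m 1≤m using (restrictedSum-vanishes; restrictedSum-count)
  open Maximum

  u : ℕ
  u = maxFin s t

  u≤m : u ≤ m
  u≤m = maxFin-lub s t m t≤m

  term-value : ∀ j → j ≤ m →
    ιR (w j) * pF s (λ i → restrictedSum (chs i) j) * pF r (λ _ → multipleCount j) ≈ ιR (term m u s r j)
  term-value j j≤m = by-cases (u ≤? j)
    where
    B-part : pF r (λ _ → multipleCount j) ≈ ιR ((p ^ (m ∸ j)) ^ r)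
    B-part = trans (pF-cong r (λ _ → multipleCount-value j j≤m)) (pF-const r (p ^ (m ∸ j)))
    by-cases : (d : Dec (u ≤ j)) →
      ιR (w j) * pF s (λ i → restrictedSum (chs i) j) * pF r (λ _ → multipleCount j)
        ≈ ιR (𝟙 d ℕ.* (w j ℕ.* congruentUnits m j ^ s ℕ.* (p ^ (m ∸ j)) ^ r))
    -- j ≥ u ≥ t_i for all i: every A_i(j) equals c_j
    by-cases (yes u≤j) = begin
      ιR (w j) * pF s (λ i → restrictedSum (chs i) j) * pF r (λ _ → multipleCount j)
        ≈⟨ *-cong (*-cong refl (trans (pF-cong s A-value) (pF-const s (congruentUnits m j)))) B-part ⟩
      ιR (w j) * ιR (congruentUnits m j ^ s) * ιR ((p ^ (m ∸ j)) ^ r)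
        ≈⟨ *-cong (sym (ι-* (w j) _)) refl ⟩
      ιR (w j ℕ.* congruentUnits m j ^ s) * ιR ((p ^ (m ∸ j)) ^ r)
        ≈⟨ sym (ι-* (w j ℕ.* congruentUnits m j ^ s) ((p ^ (m ∸ j)) ^ r)) ⟩
      ιR (w j ℕ.* congruentUnits m j ^ s ℕ.* (p ^ (m ∸ j)) ^ r)
        ≡⟨ ≡.cong ιR (≡.sym (ℕP.*-identityˡ (w j ℕ.* congruentUnits m j ^ s ℕ.* (p ^ (m ∸ j)) ^ r))) ⟩
      ιR (1 ℕ.* (w j ℕ.* congruentUnits m j ^ s ℕ.* (p ^ (m ∸ j)) ^ r)) ∎
      where
      A-value : ∀ i → restrictedSum (chs i) j ≈ ιR (congruentUnits m j)
      A-value i = restrictedSum-count (chs i) (t i) j (conductor i) (ℕP.≤-trans (≤-maxFin s t i) u≤j) j≤m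
    -- j < u = max t_i: some A_i(j) vanishes
    by-cases (no u≰j) with below-maxFin s t j (ℕP.≰⇒> u≰j)
    ... | i , j<tᵢ = trans (*-cong (*-cong refl (pF-zero s _ i (restrictedSum-vanishes (chs i) (t i) j (conductor i) j<tᵢ (t≤m i)))) refl)
                           (trans (*-cong (zeroʳ _) refl) (zeroˡ _))

  S≈Σterm : Ssum R (p ^ m) r s chs ≈ ιR (Σℕ (suc m) (term m u s r))
  S≈Σterm = begin
    Ssum R (p ^ m) r s chs                    ≈⟨ S-expansion r s chs ⟩
    ΣR (suc m) (λ j → ιR (w j) * pF s (λ i → restrictedSum (chs i) j) * pF r (λ _ → multipleCount j))
                                              ≈⟨ ΣR-cong (suc m) (λ j j<M → term-value j (ℕP.≤-pred j<M)) ⟩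
    ΣR (suc m) (λ j → ιR (term m u s r j))    ≈⟨ sym (ι-Σ (suc m) _) ⟩
    ιR (Σℕ (suc m) (term m u s r))            ∎

open import Defs
open import Data.Nat using (_+_; _*_; _∸_; suc)
open import Data.Nat.Properties using (≤-pred)
open import Data.Fin using (Fin)
open import Data.Product using (_×_; _,_)
open import Relation.Binary.PropositionalEquality using (_≡_; cong; trans)
open NatSum using (Σℕ)

theorem2p5 : {c ℓ : Level} (R : CommutativeRing c ℓ) → IsIntegralDomainChar0 R →
    (r s p m : ℕ) → 0 < s → Prime p → 1 ≤ m →
    (chs : Fin s → DirichletCharacter R (p ^ m)) →
    (t : Fin s → ℕ) → (∀ i → t i ≤ m) →
    (∀ i → HasConductor R (chs i) (p ^ t i)) →
    let open CommutativeRing R using (_≈_)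
        u = maxFin s t
        S = Ssum R (p ^ m) r s chs
    in (0 < u → S ≈ ι R (φ (p ^ m) * σ (s + r ∸ 1) (p ^ (m ∸ u))))
       × (u ≡ 0 → S ≈ ι R (φ (p ^ m) * ((φ (p ^ m) ^ (s ∸ 1)) * p ^ (m * r) + σ (s + r ∸ 1) (p ^ m) ∸ p ^ (m * (s + r ∸ 1)))))
theorem2p5 R dom r (suc s') p (suc m') _ pr 1≤m chs t t≤m conductor =
  (λ 0<u → S≈ (sum-positive u 0<u u≤m)) ,
  (λ u≡0 → S≈ (trans (cong (λ v → Σℕ (suc M) (term M v (suc s') r)) u≡0) (sum-terms-zero m' s' r)))
  where
  M = suc m'
  open Evaluation R dom p pr M 1≤m r (suc s') chs t t≤m conductor using (u; u≤m; S≈Σterm)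
  open ClosedForm p pr using (term; sum-terms-positive; sum-terms-zero)
  S≈ : ∀ {n} → Σℕ (suc M) (term M u (suc s') r) ≡ n → CommutativeRing._≈_ R (Ssum R (p ^ M) r (suc s') chs) (ι R n)
  S≈ e = CommutativeRing.trans R S≈Σterm (CommutativeRing.reflexive R (cong (ι R) e))
  sum-positive : ∀ v → 0 < v → v ≤ M → Σℕ (suc M) (term M v (suc s') r) ≡ φ (p ^ M) * σ (suc s' + r ∸ 1) (p ^ (M ∸ v))
  sum-positive (suc v') _ v≤M = sum-terms-positive m' v' s' r (≤-pred v≤M)
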